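{- Let $\mathbf{a}\in[n]^n$. For any covering relation $w\mathrel{\lessdot}w'$ of the partial order $\lesssim_{\mathbf{a}}$ on $S_n$ (i.e. $w\lesssim_{\mathbf{a}}w'$, $w\ne w'$, and no $z\notin\{w,w'\}$ satisfies $w\lesssim_{\mathbf{a}}z\lesssim_{\mathbf{a}}w'$), we have $\ell_{\mathbf{a}}(w')=\ell_{\mathbf{a}}(w)+1$. Consequently, $(S_n,\lesssim_{\mathbf{a}})$ is a ranked poset with rank function $\ell_{\mathbf{a}}$.
   Context: Permutations are in one-line notation $w=w_1\cdots w_n$, $w[k]:=\{w_1,\dots,w_k\}$. Cyclic interval $[a,b)_c$: $\{a,\dots,b-1\}$ if $a\le b$, $\{a,\dots,n\}\cup\{1,\dots,b-1\}$ if $a>b$. For $r\in[n]$, $<_r$ is the total order $r<_r r+1<_r\cdots<_r n<_r 1<_r\cdots<_r r-1$ on $[n]$; for $k$-subsets $A=\{a_1<_r\cdots<_r a_k\}$, $B=\{b_1<_r\cdots<_r b_k\}$, $A\le_r B$ means $a_i\le_r b_i$ for all $i$. For $\mathbf{a}=(a_1,\dots,a_n)\in[n]^n$: $u\lesssim_{\mathbf{a}}v$ iff $u[k]\le_{a_k}v[k]$ for all $k\in[n]$ and $|u[k]\cap[a_k,a_{k+1})_c|=|v[k]\cap[a_k,a_{k+1})_c|$ for all $k\in[n-1]$; this is a partial order on $S_n$. The $\mathbf{a}$-tilted length is $\ell_{\mathbf{a}}(w):=\#\{(i,j):1\le i<j\le n,\ w_i>_{a_i}w_j\}$. -}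

module Defs where

open import Data.Nat using (ℕ; zero; suc; _+_; _∸_; _≤_; _<_; _≤ᵇ_; _<ᵇ_)
open import Data.Nat.Properties using (≤-decTotalOrder)
open import Data.Bool using (Bool; true; false; if_then_else_; _∨_; _∧_)
open import Data.Fin using (Fin; toℕ)
open import Data.Fin.Permutation using (Permutation′; _⟨$⟩ʳ_)
open import Data.List using (List; []; _∷_; map; take; length; filter; concatMap)
open import Data.List.Relation.Binary.Pointwise using (Pointwise)
open import Data.List.Sort ≤-decTotalOrder using (sort)
open import Data.Vec.Functional using (Vector)
open import Data.List using () renaming (allFin to allFinL)
open import Data.Product using (_×_; _,_)
open import Data.Sum using (_⊎_)
open import Relation.Binary.PropositionalEquality using (_≡_)
open import Relation.Nullary using (¬_)

-- Conventions: [n] is modelled by Fin n (values 0..n-1 instead of 1..n; a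
-- uniform relabelling).  A permutation w ∈ S_n is a Permutation′ n, its
-- one-line notation is  w_i = w ⟨$⟩ʳ i  (positions also 0-indexed).

-- rank of x in the cyclic order <_r : r <_r r+1 <_r ... <_r n-1 <_r 0 <_r ... <_r r-1
rk : {n : ℕ} → Fin n → Fin n → ℕ
rk {n} r x = if toℕ r ≤ᵇ toℕ x then toℕ x ∸ toℕ r else (n + toℕ x) ∸ toℕ r

_<[_]_ : {n : ℕ} → Fin n → Fin n → Fin n → Set
x <[ r ] y = rk r x < rk r y

prefix : {n : ℕ} → Permutation′ n → ℕ → List (Fin n)
prefix {n} w k = map (w ⟨$⟩ʳ_) (take k (allFinL n))

-- A ≤_r B for k-subsets: sorting both w.r.t. <_r, a_i ≤_r b_i for all i
-- (the ranks rk r are the positions in the order <_r, so sorting ranks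
-- lists a_1 <_r ... <_r a_k).
_≤ₛ[_]_ : {n : ℕ} → List (Fin n) → Fin n → List (Fin n) → Set
A ≤ₛ[ r ] B = Pointwise _≤_ (sort (map (rk r) A)) (sort (map (rk r) B))

inCyc : {n : ℕ} → Fin n → Fin n → Fin n → Bool
inCyc a b x =
  if toℕ a ≤ᵇ toℕ b
  then (toℕ a ≤ᵇ toℕ x) ∧ (toℕ x <ᵇ toℕ b)
  else (toℕ a ≤ᵇ toℕ x) ∨ (toℕ x <ᵇ toℕ b)

countB : {A : Set} → (A → Bool) → List A → ℕ
countB p [] = 0
countB p (x ∷ xs) = if p x then suc (countB p xs) else countB p xs

-- the tilted Bruhat order  u ≲_a v.  Position index i : Fin n corresponds to
-- k = i+1, so the prefix w[k] is  prefix w (suc (toℕ i)).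
_≲[_]_ : {n : ℕ} → Permutation′ n → Vector (Fin n) n → Permutation′ n → Set
_≲[_]_ {n} u a v =
  ((i : Fin n) → prefix u (suc (toℕ i)) ≤ₛ[ a i ] prefix v (suc (toℕ i)))
  × ((i j : Fin n) → toℕ j ≡ suc (toℕ i) →
       countB (inCyc (a i) (a j)) (prefix u (suc (toℕ i)))
         ≡ countB (inCyc (a i) (a j)) (prefix v (suc (toℕ i))))

tiltedLength : {n : ℕ} → Vector (Fin n) n → Permutation′ n → ℕ
tiltedLength {n} a w =
  countB (λ ij → inv (Data.Product.proj₁ ij) (Data.Product.proj₂ ij))
         (concatMap (λ i → map (λ j → (i , j)) (allFinL n)) (allFinL n))
  where
  inv : Fin n → Fin n → Bool
  inv i j = (toℕ i <ᵇ toℕ j) ∧ (rk (a i) (w ⟨$⟩ʳ j) <ᵇ rk (a i) (w ⟨$⟩ʳ i))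

_≐_ : {n : ℕ} → Permutation′ n → Permutation′ n → Set
_≐_ {n} u v = (i : Fin n) → u ⟨$⟩ʳ i ≡ v ⟨$⟩ʳ i

Covers : {n : ℕ} → Vector (Fin n) n → Permutation′ n → Permutation′ n → Set
Covers a w w' =
  (w ≲[ a ] w') × (¬ (w ≐ w'))
  × (∀ z → w ≲[ a ] z → z ≲[ a ] w' → (z ≐ w) ⊎ (z ≐ w'))

{-# OPTIONS --safe #-}
module Submission where

-- For a cover u ⋖ v, let i be the first position where u and v differ, x = u_i and y = v_i.
-- The prefix conditions of u ≲_a v force x <_{a_i} y, and comparing prefix counts shows that
-- some later u_j lies in the cyclic interval (x, y] while no a_q with i ≤ q ≤ j does; take j
-- minimal.  Then z = u ∘ (i j) satisfies u ≲_a z ≲_a v, so z = v by the covering property, and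
-- since neither a_q (i ≤ q ≤ j) nor u_q (i < q < j) lies in (x, y], the swap makes (i, j) an
-- a-inversion and leaves the number of all other a-inversions unchanged.

open import Defs
open import Data.Nat using (ℕ; suc)
open import Data.Fin using (Fin)
open import Data.Fin.Permutation using (Permutation′)
open import Data.Vec.Functional using (Vector)
open import Relation.Binary.PropositionalEquality using (_≡_)

open import Data.Nat.Properties hiding (_≟_)
open import Algebra.Properties.CommutativeMonoid.Sum +-0-commutativeMonoid
  using (sum; sum-syntax; sum-cong-≗; sum-remove; ∑-distrib-+; sum-replicate-zero)
open import Algebra.Properties.CommutativeSemigroup +-commutativeSemigroup
  using (xy∙z≈xz∙y; xy∙z≈x∙zy; x∙yz≈xz∙y; x∙yz≈yx∙z; xy∙z≈y∙xz; x∙yz≈y∙xz)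
open import Data.Bool using (Bool; true; false; _∧_; _∨_; if_then_else_)
open import Data.Bool.Properties using (T-≡) renaming (_≟_ to _≟ᵇ_)
open import Data.Empty using (⊥-elim)
open import Data.Fin using (zero; suc; toℕ; inject₁)
open import Data.Fin.Permutation using (_⟨$⟩ʳ_; _⟨$⟩ˡ_; inverseˡ; inverseʳ; transpose; _∘ₚ_)
import Data.Fin.Permutation.Components as PC
open import Data.Fin.Properties using (toℕ-injective; toℕ<n; toℕ-inject₁; punchInᵢ≢i; _≟_; any?; ¬∀⟶∃¬)
open import Data.List as List using (List; []; _∷_; _++_; take; concatMap)
open import Data.List.Properties using (length-map)
open import Data.List.Relation.Binary.Permutation.Propositional using (_↭_; prep; swap) renaming (refl to ↭-refl; trans to ↭-trans)
open import Data.List.Relation.Binary.Permutation.Propositional.Properties using (↭-length)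
open import Data.List.Relation.Binary.Pointwise using (Pointwise; []; _∷_)
open import Data.List.Relation.Unary.Linked as Linked using (_∷_)
open import Data.List.Relation.Unary.Sorted.TotalOrder ≤-totalOrder using (Sorted)
open import Data.List.Sort ≤-decTotalOrder using (sort; sort-↭; sort-↗)
open import Data.Nat using (zero; _+_; _∸_; _≤_; _<_; _≮_; _≤ᵇ_; _<ᵇ_; z≤n; s≤s; z<s; s≤s⁻¹)
open import Data.Product using (_×_; _,_; proj₁; proj₂; Σ-syntax)
open import Data.Sum using (_⊎_; inj₁; inj₂)
open import Data.Vec.Functional using (removeAt; updateAt)
open import Data.Vec.Functional.Properties using (updateAt-updates; updateAt-minimal)
open import Function using (_∘_; _⇔_; mk⇔; Equivalence)
open import Relation.Binary using (tri<; tri≈; tri>)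
open import Relation.Binary.PropositionalEquality using (_≢_; refl; sym; trans; cong; cong₂; subst; subst₂; module ≡-Reasoning)
open import Relation.Nullary using (¬_; Dec; yes; no; _×-dec_; ¬?)
open import Relation.Nullary.Decidable using (decidable-stable)

open Equivalence using (to; from)

𝟙 : Bool → ℕ
𝟙 true  = 1
𝟙 false = 0

𝟙≤1 : ∀ b → 𝟙 b ≤ 1
𝟙≤1 true  = ≤-refl
𝟙≤1 false = z≤n

<⇒<ᵇ≡true : ∀ {m n} → m < n → (m <ᵇ n) ≡ true
<⇒<ᵇ≡true = to T-≡ ∘ <⇒<ᵇ

≤⇒≤ᵇ≡true : ∀ {m n} → m ≤ n → (m ≤ᵇ n) ≡ true
≤⇒≤ᵇ≡true = to T-≡ ∘ ≤⇒≤ᵇ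

<ᵇ≡true⇒< : ∀ {m n} → (m <ᵇ n) ≡ true → m < n
<ᵇ≡true⇒< {m} {n} = <ᵇ⇒< m n ∘ from T-≡

≤ᵇ≡true⇒≤ : ∀ {m n} → (m ≤ᵇ n) ≡ true → m ≤ n
≤ᵇ≡true⇒≤ {m} {n} = ≤ᵇ⇒≤ m n ∘ from T-≡

≮⇒<ᵇ≡false : ∀ {m n} → m ≮ n → (m <ᵇ n) ≡ false
≮⇒<ᵇ≡false {m} {n} m≮n with m <ᵇ n in eq
... | true  = ⊥-elim (m≮n (<ᵇ≡true⇒< eq))
... | false = refl

≰⇒≤ᵇ≡false : ∀ {m n} → ¬ m ≤ n → (m ≤ᵇ n) ≡ false
≰⇒≤ᵇ≡false {m} {n} m≰n with m ≤ᵇ n in eq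
... | true  = ⊥-elim (m≰n (≤ᵇ≡true⇒≤ eq))
... | false = refl

<ᵇ-cong : ∀ {m n m′ n′} → (m < n ⇔ m′ < n′) → (m <ᵇ n) ≡ (m′ <ᵇ n′)
<ᵇ-cong {m} {n} {m′} {n′} m<n⇔m′<n′ with m <? n
... | yes m<n = trans (<⇒<ᵇ≡true m<n) (sym (<⇒<ᵇ≡true (to m<n⇔m′<n′ m<n)))
... | no m≮n  = trans (≮⇒<ᵇ≡false m≮n) (sym (≮⇒<ᵇ≡false (m≮n ∘ from m<n⇔m′<n′)))

<ᵇ∧-true : ∀ {m k} b → m < k → (m <ᵇ k) ∧ b ≡ b
<ᵇ∧-true b m<k rewrite <⇒<ᵇ≡true m<k = refl

<ᵇ∧-false : ∀ {m k} b → m ≮ k → (m <ᵇ k) ∧ b ≡ false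
<ᵇ∧-false b m≮k rewrite ≮⇒<ᵇ≡false m≮k = refl

true≢false : true ≢ false
true≢false ()

∧≡true⇒ : ∀ {b c} → b ∧ c ≡ true → b ≡ true × c ≡ true
∧≡true⇒ {true} {true} _ = refl , refl

𝟙-<ᵇ-antitoneˡ : ∀ {m m′} t → m ≤ m′ → 𝟙 (m′ <ᵇ t) ≤ 𝟙 (m <ᵇ t)
𝟙-<ᵇ-antitoneˡ {m} {m′} t m≤m′ with m′ <? t
... | yes m′<t rewrite <⇒<ᵇ≡true m′<t | <⇒<ᵇ≡true (≤-<-trans m≤m′ m′<t) = ≤-refl
... | no m′≮t  rewrite ≮⇒<ᵇ≡false m′≮t = z≤n

𝟙-<ᵇ-monotoneʳ : ∀ m {t t′} → t ≤ t′ → 𝟙 (m <ᵇ t) ≤ 𝟙 (m <ᵇ t′)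
𝟙-<ᵇ-monotoneʳ m {t} t≤t′ with m <? t
... | yes m<t rewrite <⇒<ᵇ≡true m<t | <⇒<ᵇ≡true (<-≤-trans m<t t≤t′) = ≤-refl
... | no m≮t  rewrite ≮⇒<ᵇ≡false m≮t = z≤n

<-shift : ∀ {D E} d e R → d + R ≡ D → e + R ≡ E → (d < e ⇔ D < E)
<-shift d e R d+R≡D e+R≡E = mk⇔
  (λ d<e → subst₂ _<_ d+R≡D e+R≡E (+-monoˡ-< R d<e))
  (λ D<E → +-cancelʳ-< R d e (subst₂ _<_ (sym d+R≡D) (sym e+R≡E) D<E))

+-≡-≤⇒≤ : ∀ {m n c d} → m + c ≡ n + d → d ≤ c → m ≤ n
+-≡-≤⇒≤ {m} {n} {c} {d} m+c≡n+d d≤c = +-cancelʳ-≤ c m n (≤-trans (≤-reflexive m+c≡n+d) (+-monoʳ-≤ n d≤c))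

sum-mono-≤ : ∀ {n} {f g : Fin n → ℕ} → (∀ p → f p ≤ g p) → sum f ≤ sum g
sum-mono-≤ {zero}  f≤g = z≤n
sum-mono-≤ {suc n} f≤g = +-mono-≤ (f≤g zero) (sum-mono-≤ (f≤g ∘ suc))

sum-≡-except : ∀ {n} {f g : Fin n → ℕ} (i : Fin n) {c d : ℕ} →
  (∀ p → p ≢ i → f p ≡ g p) → f i + d ≡ g i + c → sum f + d ≡ sum g + c
sum-≡-except {suc n} {f} {g} i {c} {d} f≗g fi+d≡gi+c = begin
  sum f + d                     ≡⟨ cong (_+ d) (sum-remove {i = i} f) ⟩
  f i + sum (removeAt f i) + d  ≡⟨ xy∙z≈xz∙y (f i) _ d ⟩
  f i + d + sum (removeAt f i)  ≡⟨ cong₂ _+_ fi+d≡gi+c (sum-cong-≗ (λ p → f≗g _ (punchInᵢ≢i i p))) ⟩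
  g i + c + sum (removeAt g i)  ≡⟨ xy∙z≈xz∙y (g i) c _ ⟩
  g i + sum (removeAt g i) + c  ≡⟨ cong (_+ c) (sum-remove {i = i} g) ⟨
  sum g + c                     ∎
  where open ≡-Reasoning

sum-≤-except : ∀ {n} {f g : Fin n → ℕ} (i : Fin n) {c : ℕ} →
  (∀ p → p ≢ i → f p ≤ g p) → f i + c ≤ g i → sum f + c ≤ sum g
sum-≤-except {suc n} {f} {g} i {c} f≤g fi+c≤gi = begin
  sum f + c                     ≡⟨ cong (_+ c) (sum-remove {i = i} f) ⟩
  f i + sum (removeAt f i) + c  ≡⟨ xy∙z≈xz∙y (f i) _ c ⟩
  f i + c + sum (removeAt f i)  ≤⟨ +-mono-≤ fi+c≤gi (sum-mono-≤ (λ p → f≤g _ (punchInᵢ≢i i p))) ⟩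
  g i + sum (removeAt g i)      ≡⟨ sum-remove {i = i} g ⟨
  sum g                         ∎
  where open ≤-Reasoning

sum-≤⇒≤-at : ∀ {n} {f g : Fin n → ℕ} (i : Fin n) →
  (∀ p → p ≢ i → f p ≡ g p) → sum f ≤ sum g → f i ≤ g i
sum-≤⇒≤-at {f = f} {g} i f≗g ∑f≤∑g = +-cancelˡ-≤ (sum g) _ _ (begin
  sum g + f i  ≡⟨ sum-≡-except i f≗g (+-comm (f i) (g i)) ⟨
  sum f + g i  ≤⟨ +-monoˡ-≤ (g i) ∑f≤∑g ⟩
  sum g + g i  ∎)
  where open ≤-Reasoning

sum-≡-except₂ : ∀ {n} {f g : Fin n → ℕ} {i j : Fin n} {c d : ℕ} → i ≢ j →
  (∀ p → p ≢ i → p ≢ j → f p ≡ g p) → f i + f j + d ≡ g i + g j + c → sum f + d ≡ sum g + c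
sum-≡-except₂ {n} {f} {g} {i} {j} {c} {d} i≢j f≗g eq = +-cancelʳ-≡ (g i) _ _ (begin
  sum f + d + g i    ≡⟨ xy∙z≈xz∙y (sum f) d (g i) ⟩
  sum f + g i + d    ≡⟨ cong (_+ d) (sum-≡-except i f≗h (trans (+-comm (f i) (g i)) (cong (_+ f i) (sym (updateAt-updates i f))))) ⟩
  sum h + f i + d    ≡⟨ +-assoc (sum h) (f i) d ⟩
  sum h + (f i + d)  ≡⟨ sum-≡-except j h≗g hj+fi+d≡gj+gi+c ⟩
  sum g + (g i + c)  ≡⟨ x∙yz≈xz∙y (sum g) (g i) c ⟩
  sum g + c + g i    ∎)
  where
  open ≡-Reasoning
  h : Fin n → ℕ
  h = updateAt f i (λ _ → g i)
  f≗h : ∀ p → p ≢ i → f p ≡ h p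
  f≗h p p≢i = sym (updateAt-minimal p i f p≢i)
  h≗g : ∀ p → p ≢ j → h p ≡ g p
  h≗g p p≢j with p ≟ i
  ... | yes refl = updateAt-updates i f
  ... | no p≢i   = trans (updateAt-minimal p i f p≢i) (f≗g p p≢i p≢j)
  hj+fi+d≡gj+gi+c : h j + (f i + d) ≡ g j + (g i + c)
  hj+fi+d≡gj+gi+c = begin
    h j + (f i + d)  ≡⟨ cong (_+ (f i + d)) (updateAt-minimal j i f (i≢j ∘ sym)) ⟩
    f j + (f i + d)  ≡⟨ x∙yz≈yx∙z (f j) (f i) d ⟩
    f i + f j + d    ≡⟨ eq ⟩
    g i + g j + c    ≡⟨ xy∙z≈y∙xz (g i) (g j) c ⟩
    g j + (g i + c)  ∎

-- Cyclic ranks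

-- For R, Z < n this is (Z − R) mod n; in particular rk r z = cycDiff n (toℕ r) (toℕ z).
cycDiff : ℕ → ℕ → ℕ → ℕ
cycDiff n R Z = if R ≤ᵇ Z then Z ∸ R else (n + Z) ∸ R

cycDiff-≤ : ∀ n {R Z} → R ≤ Z → cycDiff n R Z + R ≡ Z
cycDiff-≤ n {R} {Z} R≤Z rewrite ≤⇒≤ᵇ≡true R≤Z = m∸n+n≡m R≤Z

cycDiff-> : ∀ n {R Z} → R < n → Z < R → cycDiff n R Z + R ≡ n + Z
cycDiff-> n {R} {Z} R<n Z<R rewrite ≰⇒≤ᵇ≡false (<⇒≱ Z<R) = m∸n+n≡m (≤-trans (<⇒≤ R<n) (m≤m+n n Z))

IsCycDiff : ℕ → ℕ → ℕ → ℕ → Set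
IsCycDiff n d R Z = d + R ≡ Z ⊎ d + R ≡ n + Z

cycDiff-isCycDiff : ∀ n {R Z} → R < n → Z < n → cycDiff n R Z < n × IsCycDiff n (cycDiff n R Z) R Z
cycDiff-isCycDiff n {R} {Z} R<n Z<n with R ≤? Z
... | yes R≤Z = +-cancelʳ-< R _ n (begin-strict
      cycDiff n R Z + R  ≡⟨ cycDiff-≤ n R≤Z ⟩
      Z                  <⟨ Z<n ⟩
      n                  ≤⟨ m≤m+n n R ⟩
      n + R              ∎) , inj₁ (cycDiff-≤ n R≤Z)
  where open ≤-Reasoning
... | no R≰Z = +-cancelʳ-< R _ n (begin-strict
      cycDiff n R Z + R  ≡⟨ cycDiff-> n R<n (≰⇒> R≰Z) ⟩
      n + Z              <⟨ +-monoʳ-< n (≰⇒> R≰Z) ⟩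
      n + R              ∎) , inj₂ (cycDiff-> n R<n (≰⇒> R≰Z))
  where open ≤-Reasoning

isCycDiff-unique : ∀ {n d e R Z} → d < n → e < n → IsCycDiff n d R Z → IsCycDiff n e R Z → d ≡ e
isCycDiff-unique _ _ (inj₁ p) (inj₁ q) = +-cancelʳ-≡ _ _ _ (trans p (sym q))
isCycDiff-unique _ _ (inj₂ p) (inj₂ q) = +-cancelʳ-≡ _ _ _ (trans p (sym q))
isCycDiff-unique {n} {d} {e} {R} d<n e<n (inj₁ p) (inj₂ q) =
  ⊥-elim (<⇒≱ e<n (subst (n ≤_) (sym e≡n+d) (m≤m+n n d)))
  where
  e≡n+d : e ≡ n + d
  e≡n+d = +-cancelʳ-≡ R _ _ (trans q (trans (cong (n +_) (sym p)) (sym (+-assoc n d R))))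
isCycDiff-unique d<n e<n p@(inj₂ _) q@(inj₁ _) = sym (isCycDiff-unique e<n d<n q p)

isCycDiff-trans : ∀ {n d A B R X Z} → d < n → X < n → Z < n →
  IsCycDiff n A R X → IsCycDiff n B R Z → IsCycDiff n d A B → IsCycDiff n d X Z
isCycDiff-trans {n} {d} {A} {B} {R} {X} {Z} d<n X<n Z<n = go
  where
  via : ∀ {X′ B′} → A + R ≡ X′ → d + A ≡ B′ → d + X′ ≡ B′ + R
  via a δ = trans (cong (d +_) (sym a)) (trans (sym (+-assoc d A R)) (cong (_+ R) δ))
  n+ : ∀ {W} → B + R ≡ W → n + B + R ≡ n + W
  n+ b = trans (+-assoc n B R) (cong (n +_) b)
  d+n+X : d + (n + X) ≡ n + (d + X)
  d+n+X = x∙yz≈y∙xz d n X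
  d+X<n+n+Z : d + X < n + (n + Z)
  d+X<n+n+Z = <-≤-trans (+-mono-< d<n X<n) (+-monoʳ-≤ n (m≤m+n n Z))
  go : IsCycDiff n A R X → IsCycDiff n B R Z → IsCycDiff n d A B → IsCycDiff n d X Z
  go (inj₁ a) (inj₁ b) (inj₁ δ) = inj₁ (trans (via a δ) b)
  go (inj₁ a) (inj₂ b) (inj₁ δ) = inj₂ (trans (via a δ) b)
  go (inj₁ a) (inj₁ b) (inj₂ δ) = inj₂ (trans (via a δ) (n+ b))
  go (inj₁ a) (inj₂ b) (inj₂ δ) = ⊥-elim (<-irrefl (trans (via a δ) (n+ b)) d+X<n+n+Z)
  go (inj₂ a) (inj₁ b) (inj₁ δ) = ⊥-elim (<⇒≱ Z<n (begin
    n            ≤⟨ m≤n+m n d ⟩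
    d + n        ≤⟨ +-monoʳ-≤ d (m≤m+n n X) ⟩
    d + (n + X)  ≡⟨ trans (via a δ) b ⟩
    Z            ∎))
    where open ≤-Reasoning
  go (inj₂ a) (inj₂ b) (inj₁ δ) = inj₁ (+-cancelˡ-≡ n _ _ (trans (sym d+n+X) (trans (via a δ) b)))
  go (inj₂ a) (inj₁ b) (inj₂ δ) = inj₁ (+-cancelˡ-≡ n _ _ (trans (sym d+n+X) (trans (via a δ) (n+ b))))
  go (inj₂ a) (inj₂ b) (inj₂ δ) = inj₂ (+-cancelˡ-≡ n _ _ (trans (sym d+n+X) (trans (via a δ) (n+ b))))

cycDiff-cocycle : ∀ n {R X Z} → R < n → X < n → Z < n → cycDiff n X Z ≡ cycDiff n (cycDiff n R X) (cycDiff n R Z)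
cycDiff-cocycle n R<n X<n Z<n =
  let A<n , A≡X−R = cycDiff-isCycDiff n R<n X<n
      B<n , B≡Z−R = cycDiff-isCycDiff n R<n Z<n
      d<n , d≡B−A = cycDiff-isCycDiff n A<n B<n
      e<n , e≡Z−X = cycDiff-isCycDiff n X<n Z<n
  in isCycDiff-unique e<n d<n e≡Z−X (isCycDiff-trans d<n X<n Z<n A≡X−R B≡Z−R d≡B−A)

cycDiff-self : ∀ n R → cycDiff n R R ≡ 0
cycDiff-self n R = +-cancelʳ-≡ R (cycDiff n R R) 0 (cycDiff-≤ n (≤-refl {R}))

module _ {n : ℕ} where

  _≤[_]_ : Fin n → Fin n → Fin n → Set
  x ≤[ r ] y = rk r x ≤ rk r y

  rk<n : ∀ r x → rk {n} r x < n
  rk<n r x = proj₁ (cycDiff-isCycDiff n (toℕ<n r) (toℕ<n x))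

  rk-cocycle : ∀ r x z → rk {n} x z ≡ cycDiff n (rk r x) (rk r z)
  rk-cocycle r x z = cycDiff-cocycle n (toℕ<n r) (toℕ<n x) (toℕ<n z)

  rk-self : ∀ r → rk {n} r r ≡ 0
  rk-self r = cycDiff-self n (toℕ r)

  rk≡0⇒≡ : ∀ {x y} → rk {n} x y ≡ 0 → x ≡ y
  rk≡0⇒≡ {x} {y} rk≡0 with toℕ x ≤? toℕ y
  ... | yes x≤y = toℕ-injective (trans (cong (_+ toℕ x) (sym rk≡0)) (cycDiff-≤ n x≤y))
  ... | no x≰y  = ⊥-elim (<⇒≱ (toℕ<n x) (begin
    n            ≤⟨ m≤m+n n (toℕ y) ⟩
    n + toℕ y    ≡⟨ cycDiff-> n (toℕ<n x) (≰⇒> x≰y) ⟨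
    rk x y + toℕ x  ≡⟨ cong (_+ toℕ x) rk≡0 ⟩
    toℕ x        ∎))
    where open ≤-Reasoning

  rk-injective : ∀ r {x y} → rk {n} r x ≡ rk r y → x ≡ y
  rk-injective r {x} {y} e = rk≡0⇒≡ (begin
    rk x y                          ≡⟨ rk-cocycle r x y ⟩
    cycDiff n (rk r x) (rk r y)     ≡⟨ cong (λ d → cycDiff n d (rk r y)) e ⟩
    cycDiff n (rk r y) (rk r y)     ≡⟨ cycDiff-self n (rk r y) ⟩
    0                               ∎)
    where open ≡-Reasoning

  _∈⟨_,_] : Fin n → Fin n → Fin n → Set
  z ∈⟨ x , y ] = 0 < rk x z × rk x z ≤ rk x y

  _∈⟨_,_]? : ∀ z x y → Dec (z ∈⟨ x , y ])
  z ∈⟨ x , y ]? = (0 <? rk x z) ×-dec (rk x z ≤? rk x y)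

  ∈⟨]⇒between : ∀ r {x y z} → x <[ r ] y → z ∈⟨ x , y ] → x <[ r ] z × z ≤[ r ] y
  ∈⟨]⇒between r {x} {y} {z} x<y (0<d , d≤e) rewrite rk-cocycle r x z | rk-cocycle r x y with rk r x ≤? rk r z
  ... | yes X≤Z = subst (rk r x <_) Z≡ (m<n+m (rk r x) 0<d) , subst₂ _≤_ Z≡ Y≡ (+-monoˡ-≤ (rk r x) d≤e)
    where
    Z≡ = cycDiff-≤ n X≤Z
    Y≡ = cycDiff-≤ n (<⇒≤ x<y)
  ... | no X≰Z = ⊥-elim (<⇒≱ (rk<n r y) (begin
    n                                          ≤⟨ m≤m+n n (rk r z) ⟩
    n + rk r z                                 ≡⟨ cycDiff-> n (rk<n r x) (≰⇒> X≰Z) ⟨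
    cycDiff n (rk r x) (rk r z) + rk r x       ≤⟨ +-monoˡ-≤ (rk r x) d≤e ⟩
    cycDiff n (rk r x) (rk r y) + rk r x       ≡⟨ cycDiff-≤ n (<⇒≤ x<y) ⟩
    rk r y                                     ∎))
    where open ≤-Reasoning

  between⇒∈⟨] : ∀ r {x y z} → x <[ r ] z → z ≤[ r ] y → z ∈⟨ x , y ]
  between⇒∈⟨] r {x} {y} {z} x<z z≤y rewrite rk-cocycle r x z | rk-cocycle r x y =
    +-cancelʳ-< (rk r x) 0 _ (subst (rk r x <_) (sym Z≡) x<z) ,
    +-cancelʳ-≤ (rk r x) _ _ (subst₂ _≤_ (sym Z≡) (sym Y≡) z≤y)
    where
    Z≡ = cycDiff-≤ n (<⇒≤ x<z)
    Y≡ = cycDiff-≤ n (<⇒≤ (<-≤-trans x<z z≤y))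

  >⇒base∈⟨] : ∀ r {x y} → y <[ r ] x → r ∈⟨ x , y ]
  >⇒base∈⟨] r {x} {y} y<x rewrite rk-cocycle r x r | rk-cocycle r x y | rk-self r =
    +-cancelʳ-< (rk r x) 0 _ (subst (rk r x <_) (sym (trans R≡ (+-identityʳ n))) (rk<n r x)) ,
    +-cancelʳ-≤ (rk r x) _ _ (subst₂ _≤_ (sym R≡) (sym Y≡) (+-monoʳ-≤ n z≤n))
    where
    R≡ = cycDiff-> n (rk<n r x) (≤-<-trans z≤n y<x)
    Y≡ = cycDiff-> n (rk<n r x) y<x

  <⇒base∉⟨] : ∀ r {x y} → x <[ r ] y → ¬ r ∈⟨ x , y ]
  <⇒base∉⟨] r {x} x<y r∈ = n≮0 (subst (rk r x <_) (rk-self r) (proj₁ (∈⟨]⇒between r x<y r∈)))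

  base∉⟨]⇒< : ∀ r {x y} → x ≢ y → ¬ r ∈⟨ x , y ] → x <[ r ] y
  base∉⟨]⇒< r {x} {y} x≢y r∉ with <-cmp (rk r x) (rk r y)
  ... | tri< x<y _ _ = x<y
  ... | tri≈ _ x≡y _ = ⊥-elim (x≢y (rk-injective r x≡y))
  ... | tri> _ _ y<x = ⊥-elim (r∉ (>⇒base∈⟨] r y<x))

  inCyc-≤ : ∀ {a b} z → toℕ a ≤ toℕ b → inCyc {n} a b z ≡ (toℕ a ≤ᵇ toℕ z) ∧ (toℕ z <ᵇ toℕ b)
  inCyc-≤ z a≤b rewrite ≤⇒≤ᵇ≡true a≤b = refl

  inCyc-> : ∀ {a b} z → ¬ toℕ a ≤ toℕ b → inCyc {n} a b z ≡ (toℕ a ≤ᵇ toℕ z) ∨ (toℕ z <ᵇ toℕ b)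
  inCyc-> z a≰b rewrite ≰⇒≤ᵇ≡false a≰b = refl

  inCyc≡<[] : ∀ a b z → inCyc {n} a b z ≡ (rk a z <ᵇ rk a b)
  inCyc≡<[] a b z = by-cases (toℕ a ≤? toℕ b) (toℕ a ≤? toℕ z)
    where
    open ≡-Reasoning
    shift : ∀ {D E} → rk a z + toℕ a ≡ D → rk a b + toℕ a ≡ E → (rk a z < rk a b ⇔ D < E)
    shift = <-shift (rk a z) (rk a b) (toℕ a)
    z↑ : ¬ toℕ a ≤ toℕ z → rk a z + toℕ a ≡ n + toℕ z
    z↑ a≰z = cycDiff-> n (toℕ<n a) (≰⇒> a≰z)
    b↑ : ¬ toℕ a ≤ toℕ b → rk a b + toℕ a ≡ n + toℕ b
    b↑ a≰b = cycDiff-> n (toℕ<n a) (≰⇒> a≰b)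
    by-cases : Dec (toℕ a ≤ toℕ b) → Dec (toℕ a ≤ toℕ z) → inCyc a b z ≡ (rk a z <ᵇ rk a b)
    by-cases (yes a≤b) (yes a≤z) = begin
      inCyc a b z                          ≡⟨ inCyc-≤ z a≤b ⟩
      (toℕ a ≤ᵇ toℕ z) ∧ (toℕ z <ᵇ toℕ b)  ≡⟨ cong (_∧ _) (≤⇒≤ᵇ≡true a≤z) ⟩
      toℕ z <ᵇ toℕ b                       ≡⟨ <ᵇ-cong (shift (cycDiff-≤ n a≤z) (cycDiff-≤ n a≤b)) ⟨
      rk a z <ᵇ rk a b                     ∎
    by-cases (yes a≤b) (no a≰z) = begin
      inCyc a b z                          ≡⟨ inCyc-≤ z a≤b ⟩
      (toℕ a ≤ᵇ toℕ z) ∧ (toℕ z <ᵇ toℕ b)  ≡⟨ cong (_∧ _) (≰⇒≤ᵇ≡false a≰z) ⟩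
      false                                ≡⟨ ≮⇒<ᵇ≡false (λ z<b → <⇒≱ (toℕ<n b)
                                                 (≤-trans (m≤m+n n (toℕ z)) (<⇒≤ (to (shift (z↑ a≰z) (cycDiff-≤ n a≤b)) z<b)))) ⟨
      rk a z <ᵇ rk a b                     ∎
    by-cases (no a≰b) (yes a≤z) = begin
      inCyc a b z                          ≡⟨ inCyc-> z a≰b ⟩
      (toℕ a ≤ᵇ toℕ z) ∨ (toℕ z <ᵇ toℕ b)  ≡⟨ cong (_∨ _) (≤⇒≤ᵇ≡true a≤z) ⟩
      true                                 ≡⟨ <⇒<ᵇ≡true (from (shift (cycDiff-≤ n a≤z) (b↑ a≰b))
                                                 (<-≤-trans (toℕ<n z) (m≤m+n n (toℕ b)))) ⟨
      rk a z <ᵇ rk a b                     ∎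
    by-cases (no a≰b) (no a≰z) = begin
      inCyc a b z                          ≡⟨ inCyc-> z a≰b ⟩
      (toℕ a ≤ᵇ toℕ z) ∨ (toℕ z <ᵇ toℕ b)  ≡⟨ cong (_∨ _) (≰⇒≤ᵇ≡false a≰z) ⟩
      toℕ z <ᵇ toℕ b                       ≡⟨ <ᵇ-cong (mk⇔ (+-monoʳ-< n) (+-cancelˡ-< n _ _)) ⟩
      n + toℕ z <ᵇ n + toℕ b               ≡⟨ <ᵇ-cong (shift (z↑ a≰z) (b↑ a≰b)) ⟨
      rk a z <ᵇ rk a b                     ∎

below : ∀ {n} → Fin n → ℕ → Fin n → Bool
below r t z = rk r z <ᵇ t

cycDiff-<ᵇ-split : ∀ n {X Y W} → X < Y → Y < n →
  𝟙 (W <ᵇ Y) ≡ 𝟙 (W <ᵇ X) + 𝟙 (cycDiff n X W <ᵇ cycDiff n X Y)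
cycDiff-<ᵇ-split n {X} {Y} {W} X<Y Y<n with X ≤? W
... | yes X≤W rewrite ≮⇒<ᵇ≡false (≤⇒≯ X≤W) =
  cong 𝟙 (sym (<ᵇ-cong (<-shift (cycDiff n X W) (cycDiff n X Y) X (cycDiff-≤ n X≤W) (cycDiff-≤ n (<⇒≤ X<Y)))))
... | no X≰W rewrite <⇒<ᵇ≡true (<-trans (≰⇒> X≰W) X<Y) | <⇒<ᵇ≡true (≰⇒> X≰W) =
  cong (λ b → 1 + 𝟙 b) (sym (≮⇒<ᵇ≡false (λ lt → <⇒≱ Y<n (≤-trans (m≤m+n n W) (<⇒≤ (to (<-shift _ _ X
    (cycDiff-> n (<-trans X<Y Y<n) (≰⇒> X≰W)) (cycDiff-≤ n (<⇒≤ X<Y))) lt))))))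

below-split-inCyc : ∀ {n} (r : Fin n) {x y} → x <[ r ] y → ∀ w →
  𝟙 (below r (rk r y) w) ≡ 𝟙 (below r (rk r x) w) + 𝟙 (inCyc x y w)
below-split-inCyc {n} r {x} {y} x<y w = begin
  𝟙 (below r (rk r y) w)                                                       ≡⟨ cycDiff-<ᵇ-split n x<y (rk<n r y) ⟩
  𝟙 (below r (rk r x) w) + 𝟙 (cycDiff n (rk r x) (rk r w) <ᵇ cycDiff n (rk r x) (rk r y))
    ≡⟨ cong (λ b → 𝟙 (below r (rk r x) w) + 𝟙 b) inCyc≡ ⟨
  𝟙 (below r (rk r x) w) + 𝟙 (inCyc x y w)                                     ∎
  where
  open ≡-Reasoning
  inCyc≡ : inCyc x y w ≡ (cycDiff n (rk r x) (rk r w) <ᵇ cycDiff n (rk r x) (rk r y))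
  inCyc≡ = trans (inCyc≡<[] x y w) (cong₂ _<ᵇ_ (rk-cocycle r x w) (rk-cocycle r x y))

below-outside : ∀ {n} (r : Fin n) {x y w t} → ¬ w ∈⟨ x , y ] → rk r x < t → t ≤ suc (rk r y) →
  below r (suc (rk r y)) w ≡ below r t w
below-outside r {x} {y} {w} {t} w∉ x<t t≤y+1 = <ᵇ-cong (mk⇔ w≤y⇒w<t (λ w<t → <-≤-trans w<t t≤y+1))
  where
  w≤y⇒w<t : rk r w < suc (rk r y) → rk r w < t
  w≤y⇒w<t w<y+1 with rk r w <? t
  ... | yes w<t = w<t
  ... | no w≮t  = ⊥-elim (w∉ (between⇒∈⟨] r (<-≤-trans x<t (≮⇒≥ w≮t)) (s≤s⁻¹ w<y+1)))

window : ∀ {n} → Fin n → ℕ → ℕ → Fin n → Bool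
window r S Y z = (S ≤ᵇ rk r z) ∧ (rk r z ≤ᵇ Y)

below-split-window : ∀ {n} (r s : Fin n) {Y} → rk r s ≤ Y → ∀ z →
  𝟙 (below r (suc Y) z) ≡ 𝟙 (inCyc r s z) + 𝟙 (window r (rk r s) Y z)
below-split-window r s {Y} s≤Y z rewrite inCyc≡<[] r s z with rk r z <? rk r s
... | yes z<S rewrite <⇒<ᵇ≡true z<S | ≰⇒≤ᵇ≡false (<⇒≱ z<S) | <⇒<ᵇ≡true (s≤s (≤-trans (<⇒≤ z<S) s≤Y)) = refl
... | no z≮S rewrite ≮⇒<ᵇ≡false z≮S | ≤⇒≤ᵇ≡true (≮⇒≥ z≮S) with rk r z ≤? Y
...   | yes z≤Y rewrite ≤⇒≤ᵇ≡true z≤Y | <⇒<ᵇ≡true (s≤s z≤Y) = refl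
...   | no z≰Y  rewrite ≰⇒≤ᵇ≡false z≰Y | ≮⇒<ᵇ≡false (z≰Y ∘ s≤s⁻¹) = refl

countB-∷ : ∀ {A : Set} (P : A → Bool) x xs → countB P (x ∷ xs) ≡ 𝟙 (P x) + countB P xs
countB-∷ P x xs with P x
... | true  = refl
... | false = refl

countB-↭ : ∀ {A : Set} (P : A → Bool) {xs ys : List A} → xs ↭ ys → countB P xs ≡ countB P ys
countB-↭ P ↭-refl = refl
countB-↭ P (prep x xs↭ys) with P x
... | true  = cong suc (countB-↭ P xs↭ys)
... | false = countB-↭ P xs↭ys
countB-↭ P (swap x y xs↭ys) with P x | P y
... | true  | true  = cong (λ c → suc (suc c)) (countB-↭ P xs↭ys)
... | true  | false = cong suc (countB-↭ P xs↭ys)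
... | false | true  = cong suc (countB-↭ P xs↭ys)
... | false | false = countB-↭ P xs↭ys
countB-↭ P (↭-trans xs↭ys ys↭zs) = trans (countB-↭ P xs↭ys) (countB-↭ P ys↭zs)

countB-map : ∀ {A B : Set} (P : B → Bool) (f : A → B) xs → countB P (List.map f xs) ≡ countB (P ∘ f) xs
countB-map P f []       = refl
countB-map P f (x ∷ xs) with P (f x)
... | true  = cong suc (countB-map P f xs)
... | false = countB-map P f xs

countB-++ : ∀ {A : Set} (P : A → Bool) xs ys → countB P (xs ++ ys) ≡ countB P xs + countB P ys
countB-++ P []       ys = refl
countB-++ P (x ∷ xs) ys with P x
... | true  = cong suc (countB-++ P xs ys)
... | false = countB-++ P xs ys

countB-tabulate : ∀ {A : Set} {n} (P : A → Bool) (f : Fin n → A) → countB P (List.tabulate f) ≡ ∑[ p < n ] 𝟙 (P (f p))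
countB-tabulate {n = zero}  P f = refl
countB-tabulate {n = suc n} P f =
  trans (countB-∷ P (f zero) (List.tabulate (f ∘ suc))) (cong (𝟙 (P (f zero)) +_) (countB-tabulate P (f ∘ suc)))

countB-take-tabulate : ∀ {A : Set} {n} (P : A → Bool) (f : Fin n → A) k →
  countB P (take k (List.tabulate f)) ≡ ∑[ p < n ] 𝟙 ((toℕ p <ᵇ k) ∧ P (f p))
countB-take-tabulate {n = zero}  P f zero    = refl
countB-take-tabulate {n = zero}  P f (suc k) = refl
countB-take-tabulate {n = suc n} P f zero    = sym (sum-replicate-zero (suc n))
countB-take-tabulate {n = suc n} P f (suc k) =
  trans (countB-∷ P (f zero) (take k (List.tabulate (f ∘ suc)))) (cong (𝟙 (P (f zero)) +_) (countB-take-tabulate P (f ∘ suc) k))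

countB-concatMap-tabulate : ∀ {A B : Set} {n} (P : B → Bool) (f : A → List B) (g : Fin n → A) →
  countB P (concatMap f (List.tabulate g)) ≡ ∑[ p < n ] countB P (f (g p))
countB-concatMap-tabulate {n = zero}  P f g = refl
countB-concatMap-tabulate {n = suc n} P f g =
  trans (countB-++ P (f (g zero)) _) (cong (countB P (f (g zero)) +_) (countB-concatMap-tabulate P f (g ∘ suc)))

sorted-countB-<ᵇ≡0 : ∀ {t y ys} → t ≤ y → Sorted (y ∷ ys) → countB (_<ᵇ t) (y ∷ ys) ≡ 0
sorted-countB-<ᵇ≡0 {t} {y} {ys} t≤y sorted rewrite ≮⇒<ᵇ≡false (≤⇒≯ t≤y) with ys | sorted
... | []      | _            = refl
... | _ ∷ _   | y≤y′ ∷ sorted′ = sorted-countB-<ᵇ≡0 (≤-trans t≤y y≤y′) sorted′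

countB-<ᵇ-∷ : ∀ {t y} ys → y < t → countB (_<ᵇ t) (y ∷ ys) ≡ suc (countB (_<ᵇ t) ys)
countB-<ᵇ-∷ ys y<t rewrite <⇒<ᵇ≡true y<t = refl

Pointwise-≤⇒countB-<ᵇ-≥ : ∀ {xs ys} → Sorted ys → Pointwise _≤_ xs ys → ∀ t → countB (_<ᵇ t) ys ≤ countB (_<ᵇ t) xs
Pointwise-≤⇒countB-<ᵇ-≥ _ [] t = z≤n
Pointwise-≤⇒countB-<ᵇ-≥ {x ∷ xs} {y ∷ ys} sorted (x≤y ∷ xs≤ys) t with y <? t
... | yes y<t = begin
  countB (_<ᵇ t) (y ∷ ys)   ≡⟨ countB-<ᵇ-∷ ys y<t ⟩
  suc (countB (_<ᵇ t) ys)   ≤⟨ s≤s (Pointwise-≤⇒countB-<ᵇ-≥ (Linked.tail sorted) xs≤ys t) ⟩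
  suc (countB (_<ᵇ t) xs)   ≡⟨ countB-<ᵇ-∷ xs (≤-<-trans x≤y y<t) ⟨
  countB (_<ᵇ t) (x ∷ xs)   ∎
  where open ≤-Reasoning
... | no y≮t = ≤-trans (≤-reflexive (sorted-countB-<ᵇ≡0 (≮⇒≥ y≮t) sorted)) z≤n

countB-≤-∷ : ∀ {A : Set} (P : A → Bool) x xs → countB P xs ≤ countB P (x ∷ xs)
countB-≤-∷ P x xs = ≤-trans (m≤n+m _ (𝟙 (P x))) (≤-reflexive (sym (countB-∷ P x xs)))

countB-<ᵇ-≥⇒Pointwise-≤ : ∀ {xs ys} → Sorted xs → Sorted ys → List.length xs ≡ List.length ys →
  (∀ t → countB (_<ᵇ t) ys ≤ countB (_<ᵇ t) xs) → Pointwise _≤_ xs ys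
countB-<ᵇ-≥⇒Pointwise-≤ {[]}     {[]}     _  _  _   _      = []
countB-<ᵇ-≥⇒Pointwise-≤ {x ∷ xs} {y ∷ ys} sx sy len counts =
  x≤y ∷ countB-<ᵇ-≥⇒Pointwise-≤ (Linked.tail sx) (Linked.tail sy) (suc-injective len) tail-counts
  where
  x≤y : x ≤ y
  x≤y with x ≤? y
  ... | yes x≤y = x≤y
  ... | no x≰y  = ⊥-elim (<⇒≱ z<s (begin
    suc (countB (_<ᵇ suc y) ys)  ≡⟨ countB-<ᵇ-∷ ys ≤-refl ⟨
    countB (_<ᵇ suc y) (y ∷ ys)  ≤⟨ counts (suc y) ⟩
    countB (_<ᵇ suc y) (x ∷ xs)  ≡⟨ sorted-countB-<ᵇ≡0 (≰⇒> x≰y) sx ⟩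
    0                            ∎))
    where open ≤-Reasoning
  tail-counts : ∀ t → countB (_<ᵇ t) ys ≤ countB (_<ᵇ t) xs
  tail-counts t with x <? t | y <? t
  ... | yes x<t | yes y<t = s≤s⁻¹ (subst₂ _≤_ (countB-<ᵇ-∷ ys y<t) (countB-<ᵇ-∷ xs x<t) (counts t))
  ... | _       | no y≮t  = ≤-trans (countB-≤-∷ (_<ᵇ t) y ys) (≤-trans (≤-reflexive (sorted-countB-<ᵇ≡0 (≮⇒≥ y≮t) sy)) z≤n)
  ... | no x≮t  | yes _   = ≤-trans (begin
    countB (_<ᵇ t) ys        ≤⟨ countB-≤-∷ (_<ᵇ t) y ys ⟩
    countB (_<ᵇ t) (y ∷ ys)  ≤⟨ counts t ⟩
    countB (_<ᵇ t) (x ∷ xs)  ≡⟨ sorted-countB-<ᵇ≡0 (≮⇒≥ x≮t) sx ⟩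
    0                        ∎) z≤n
    where open ≤-Reasoning

countWhere : ∀ {n} {A : Set} → (Fin n → Bool) → (Fin n → A) → (A → Bool) → ℕ
countWhere {n} S w P = ∑[ p < n ] 𝟙 (S p ∧ P (w p))

prefixCount : ∀ {n} {A : Set} → (Fin n → A) → ℕ → (A → Bool) → ℕ
prefixCount w k = countWhere (λ p → toℕ p <ᵇ k) w

countWhere-split : ∀ {n} {A : Set} (S : Fin n → Bool) (w : Fin n → A) {P Q R : A → Bool} →
  (∀ z → 𝟙 (P z) ≡ 𝟙 (Q z) + 𝟙 (R z)) → countWhere S w P ≡ countWhere S w Q + countWhere S w R
countWhere-split {n} S w {P} {Q} {R} P≡Q+R =
  trans (sum-cong-≗ split) (∑-distrib-+ (λ p → 𝟙 (S p ∧ Q (w p))) (λ p → 𝟙 (S p ∧ R (w p))))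
  where
  split : ∀ p → 𝟙 (S p ∧ P (w p)) ≡ 𝟙 (S p ∧ Q (w p)) + 𝟙 (S p ∧ R (w p))
  split p with S p
  ... | true  = P≡Q+R (w p)
  ... | false = refl

countWhere-+-≤ : ∀ {n} {A : Set} (S : Fin n → Bool) {P Q : A → Bool} {w₁ w₂ w₃ w₄ : Fin n → A} →
  (∀ p → S p ≡ true → 𝟙 (P (w₁ p)) + 𝟙 (Q (w₂ p)) ≤ 𝟙 (P (w₃ p)) + 𝟙 (Q (w₄ p))) →
  countWhere S w₁ P + countWhere S w₂ Q ≤ countWhere S w₃ P + countWhere S w₄ Q
countWhere-+-≤ {n} {A} S {P} {Q} {w₁} {w₂} {w₃} {w₄} pointwise = begin
  countWhere S w₁ P + countWhere S w₂ Q                 ≡⟨ ∑-distrib-+ (term P w₁) (term Q w₂) ⟨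
  ∑[ p < n ] (term P w₁ p + term Q w₂ p)                ≤⟨ sum-mono-≤ pointwise′ ⟩
  ∑[ p < n ] (term P w₃ p + term Q w₄ p)                ≡⟨ ∑-distrib-+ (term P w₃) (term Q w₄) ⟩
  countWhere S w₃ P + countWhere S w₄ Q                 ∎
  where
  open ≤-Reasoning
  term : (A → Bool) → (Fin n → A) → Fin n → ℕ
  term P w p = 𝟙 (S p ∧ P (w p))
  pointwise′ : ∀ p → term P w₁ p + term Q w₂ p ≤ term P w₃ p + term Q w₄ p
  pointwise′ p with S p in Sp
  ... | true  = pointwise p Sp
  ... | false = z≤n

module _ {n : ℕ} where

  transpose-at-i : ∀ (i j : Fin n) → PC.transpose i j i ≡ j
  transpose-at-i i j with i ≟ i
  ... | yes _   = refl
  ... | no i≢i  = ⊥-elim (i≢i refl)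

  transpose-at-j : ∀ (i j : Fin n) → PC.transpose i j j ≡ i
  transpose-at-j i j with j ≟ i
  ... | yes j≡i = j≡i
  ... | no _ with j ≟ j
  ...   | yes _  = refl
  ...   | no j≢j = ⊥-elim (j≢j refl)

  transpose-elsewhere : ∀ {i j p : Fin n} → p ≢ i → p ≢ j → PC.transpose i j p ≡ p
  transpose-elsewhere {i} {j} {p} p≢i p≢j with p ≟ i
  ... | yes p≡i = ⊥-elim (p≢i p≡i)
  ... | no _ with p ≟ j
  ...   | yes p≡j = ⊥-elim (p≢j p≡j)
  ...   | no _    = refl

  countWhere-transpose : ∀ {A : Set} (S : Fin n → Bool) (w : Fin n → A) (P : A → Bool) {i j} → i ≢ j →
    countWhere S (w ∘ PC.transpose i j) P + (𝟙 (S i ∧ P (w i)) + 𝟙 (S j ∧ P (w j)))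
      ≡ countWhere S w P + (𝟙 (S i ∧ P (w j)) + 𝟙 (S j ∧ P (w i)))
  countWhere-transpose S w P {i} {j} i≢j = sum-≡-except₂ i≢j outside at-i-j
    where
    outside : ∀ p → p ≢ i → p ≢ j → 𝟙 (S p ∧ P (w (PC.transpose i j p))) ≡ 𝟙 (S p ∧ P (w p))
    outside p p≢i p≢j = cong (λ q → 𝟙 (S p ∧ P (w q))) (transpose-elsewhere p≢i p≢j)
    at-i-j : 𝟙 (S i ∧ P (w (PC.transpose i j i))) + 𝟙 (S j ∧ P (w (PC.transpose i j j))) + (𝟙 (S i ∧ P (w i)) + 𝟙 (S j ∧ P (w j)))
           ≡ 𝟙 (S i ∧ P (w i)) + 𝟙 (S j ∧ P (w j)) + (𝟙 (S i ∧ P (w j)) + 𝟙 (S j ∧ P (w i)))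
    at-i-j rewrite transpose-at-i i j | transpose-at-j i j = +-comm (𝟙 (S i ∧ P (w j)) + 𝟙 (S j ∧ P (w i))) _

  countWhere-transpose-≡ : ∀ {A : Set} (S : Fin n → Bool) (w : Fin n → A) (P : A → Bool) {i j} → i ≢ j → S i ≡ S j →
    countWhere S (w ∘ PC.transpose i j) P ≡ countWhere S w P
  countWhere-transpose-≡ S w P {i} {j} i≢j Si≡Sj = +-cancelʳ-≡ _ _ _ (begin
    Z + (𝟙 (S i ∧ P (w i)) + 𝟙 (S i ∧ P (w j)))  ≡⟨ cong (λ b → Z + (𝟙 (S i ∧ P (w i)) + 𝟙 (b ∧ P (w j)))) Si≡Sj ⟩
    Z + (𝟙 (S i ∧ P (w i)) + 𝟙 (S j ∧ P (w j)))  ≡⟨ countWhere-transpose S w P i≢j ⟩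
    W + (𝟙 (S i ∧ P (w j)) + 𝟙 (S j ∧ P (w i)))  ≡⟨ cong (λ b → W + (𝟙 (S i ∧ P (w j)) + 𝟙 (b ∧ P (w i)))) Si≡Sj ⟨
    W + (𝟙 (S i ∧ P (w j)) + 𝟙 (S i ∧ P (w i)))  ≡⟨ cong (W +_) (+-comm (𝟙 (S i ∧ P (w j))) _) ⟩
    W + (𝟙 (S i ∧ P (w i)) + 𝟙 (S i ∧ P (w j)))  ∎)
    where
    open ≡-Reasoning
    Z W : ℕ
    Z = countWhere S (w ∘ PC.transpose i j) P
    W = countWhere S w P

  countWhere-transpose-inˡ : ∀ {A : Set} (S : Fin n → Bool) (w : Fin n → A) (P : A → Bool) {i j} → S i ≡ true → S j ≡ false →
    countWhere S (w ∘ PC.transpose i j) P + 𝟙 (P (w i)) ≡ countWhere S w P + 𝟙 (P (w j))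
  countWhere-transpose-inˡ S w P {i} {j} Si Sj = begin
    Z + 𝟙 (P (w i))                                ≡⟨ cong (Z +_) (+-identityʳ _) ⟨
    Z + (𝟙 (P (w i)) + 0)                          ≡⟨ cong₂ (λ b c → Z + (𝟙 (b ∧ P (w i)) + 𝟙 (c ∧ P (w j)))) Si Sj ⟨
    Z + (𝟙 (S i ∧ P (w i)) + 𝟙 (S j ∧ P (w j)))    ≡⟨ countWhere-transpose S w P i≢j ⟩
    W + (𝟙 (S i ∧ P (w j)) + 𝟙 (S j ∧ P (w i)))    ≡⟨ cong₂ (λ b c → W + (𝟙 (b ∧ P (w j)) + 𝟙 (c ∧ P (w i)))) Si Sj ⟩
    W + (𝟙 (P (w j)) + 0)                          ≡⟨ cong (W +_) (+-identityʳ _) ⟩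
    W + 𝟙 (P (w j))                                ∎
    where
    open ≡-Reasoning
    i≢j : i ≢ j
    i≢j i≡j = true≢false (trans (sym Si) (trans (cong S i≡j) Sj))
    Z W : ℕ
    Z = countWhere S (w ∘ PC.transpose i j) P
    W = countWhere S w P

  countWhere-transpose-inʳ : ∀ {A : Set} (S : Fin n → Bool) (w : Fin n → A) (P : A → Bool) {i j} → S i ≡ false → S j ≡ true →
    countWhere S (w ∘ PC.transpose i j) P + 𝟙 (P (w j)) ≡ countWhere S w P + 𝟙 (P (w i))
  countWhere-transpose-inʳ S w P {i} {j} Si Sj = begin
    Z + 𝟙 (P (w j))                                ≡⟨ cong₂ (λ b c → Z + (𝟙 (b ∧ P (w i)) + 𝟙 (c ∧ P (w j)))) Si Sj ⟨
    Z + (𝟙 (S i ∧ P (w i)) + 𝟙 (S j ∧ P (w j)))    ≡⟨ countWhere-transpose S w P i≢j ⟩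
    W + (𝟙 (S i ∧ P (w j)) + 𝟙 (S j ∧ P (w i)))    ≡⟨ cong₂ (λ b c → W + (𝟙 (b ∧ P (w j)) + 𝟙 (c ∧ P (w i)))) Si Sj ⟩
    W + 𝟙 (P (w i))                                ∎
    where
    open ≡-Reasoning
    i≢j : i ≢ j
    i≢j i≡j = true≢false (trans (sym Sj) (trans (cong S (sym i≡j)) Si))
    Z W : ℕ
    Z = countWhere S (w ∘ PC.transpose i j) P
    W = countWhere S w P

least-witness : ∀ {n} {P : Fin n → Set} → (∀ p → Dec (P p)) → ∀ {p} → P p →
  Σ[ q ∈ Fin n ] (P q × (∀ r → toℕ r < toℕ q → ¬ P r))
least-witness {suc n} {P} P? {p} Pp with P? zero
... | yes P0 = zero , P0 , λ _ ()
... | no ¬P0 with p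
...   | zero   = ⊥-elim (¬P0 Pp)
...   | suc p′ with least-witness (P? ∘ suc) Pp
...     | q , Pq , q-least = suc q , Pq , earlier
  where
  earlier : ∀ r → toℕ r < suc (toℕ q) → ¬ P r
  earlier zero    _         = ¬P0
  earlier (suc r) (s≤s r<q) = q-least r r<q

predecessor : ∀ {n} (K : Fin n) → 0 < toℕ K → Σ[ k ∈ Fin n ] toℕ K ≡ suc (toℕ k)
predecessor {suc n} (suc k) _ = inject₁ k , cong suc (sym (toℕ-inject₁ k))

⟨$⟩ʳ-injective : ∀ {n} (π : Permutation′ n) {p q} → π ⟨$⟩ʳ p ≡ π ⟨$⟩ʳ q → p ≡ q
⟨$⟩ʳ-injective π {p} {q} πp≡πq = trans (sym (inverseˡ π)) (trans (cong (π ⟨$⟩ˡ_) πp≡πq) (inverseˡ π))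

-- The tilted order in terms of counts

module _ {n : ℕ} where

  countB-prefix : ∀ (w : Permutation′ n) k P → countB P (prefix w k) ≡ prefixCount (w ⟨$⟩ʳ_) k P
  countB-prefix w k P = trans (countB-map P (w ⟨$⟩ʳ_) (take k (List.allFin n))) (countB-take-tabulate (P ∘ (w ⟨$⟩ʳ_)) (λ p → p) k)

  countB-sorted-ranks : ∀ (w : Permutation′ n) k r t →
    countB (_<ᵇ t) (sort (List.map (rk r) (prefix w k))) ≡ prefixCount (w ⟨$⟩ʳ_) k (below r t)
  countB-sorted-ranks w k r t = begin
    countB (_<ᵇ t) (sort (List.map (rk r) (prefix w k)))  ≡⟨ countB-↭ (_<ᵇ t) (sort-↭ _) ⟩
    countB (_<ᵇ t) (List.map (rk r) (prefix w k))         ≡⟨ countB-map (_<ᵇ t) (rk r) (prefix w k) ⟩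
    countB (below r t) (prefix w k)                       ≡⟨ countB-prefix w k (below r t) ⟩
    prefixCount (w ⟨$⟩ʳ_) k (below r t)                   ∎
    where open ≡-Reasoning

  length-sorted-ranks : ∀ (w : Permutation′ n) k r → List.length (sort (List.map (rk r) (prefix w k))) ≡ List.length (take k (List.allFin n))
  length-sorted-ranks w k r = begin
    List.length (sort (List.map (rk r) (prefix w k)))  ≡⟨ ↭-length (sort-↭ _) ⟩
    List.length (List.map (rk r) (prefix w k))         ≡⟨ length-map (rk r) (prefix w k) ⟩
    List.length (prefix w k)                           ≡⟨ length-map (w ⟨$⟩ʳ_) (take k (List.allFin n)) ⟩
    List.length (take k (List.allFin n))               ∎
    where open ≡-Reasoning

  ≤ₛ⇔prefixCount-below-≥ : ∀ (u v : Permutation′ n) k r →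
    prefix u k ≤ₛ[ r ] prefix v k ⇔ (∀ t → prefixCount (v ⟨$⟩ʳ_) k (below r t) ≤ prefixCount (u ⟨$⟩ʳ_) k (below r t))
  ≤ₛ⇔prefixCount-below-≥ u v k r = mk⇔
    (λ u≤v t → subst₂ _≤_ (countB-sorted-ranks v k r t) (countB-sorted-ranks u k r t)
                 (Pointwise-≤⇒countB-<ᵇ-≥ (sort-↗ _) u≤v t))
    (λ counts → countB-<ᵇ-≥⇒Pointwise-≤ (sort-↗ _) (sort-↗ _)
                 (trans (length-sorted-ranks u k r) (sym (length-sorted-ranks v k r)))
                 (λ t → subst₂ _≤_ (sym (countB-sorted-ranks v k r t)) (sym (countB-sorted-ranks u k r t)) (counts t)))

module _ {n : ℕ} (a : Vector (Fin n) n) where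

  lowCount : (Fin n → Fin n) → Fin n → ℕ → ℕ
  lowCount w k t = prefixCount w (suc (toℕ k)) (below (a k) t)

  cyclicCount : (Fin n → Fin n) → Fin n → Fin n → ℕ
  cyclicCount w k k′ = prefixCount w (suc (toℕ k)) (inCyc (a k) (a k′))

  record Dominated (u v : Fin n → Fin n) : Set where
    field
      lowCount-≥    : ∀ k t → lowCount v k t ≤ lowCount u k t
      cyclicCount-≡ : ∀ k k′ → toℕ k′ ≡ suc (toℕ k) → cyclicCount u k k′ ≡ cyclicCount v k k′

  countB-prefix-inCyc : ∀ w k k′ → countB (inCyc (a k) (a k′)) (prefix w (suc (toℕ k))) ≡ cyclicCount (w ⟨$⟩ʳ_) k k′
  countB-prefix-inCyc w k k′ = countB-prefix w (suc (toℕ k)) (inCyc (a k) (a k′))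

  ≲⇒Dominated : ∀ {u v} → u ≲[ a ] v → Dominated (u ⟨$⟩ʳ_) (v ⟨$⟩ʳ_)
  ≲⇒Dominated {u} {v} (u≤v , u≡v) = record
    { lowCount-≥    = λ k → to (≤ₛ⇔prefixCount-below-≥ u v (suc (toℕ k)) (a k)) (u≤v k)
    ; cyclicCount-≡ = λ k k′ k′≡k+1 → trans (sym (countB-prefix-inCyc u k k′)) (trans (u≡v k k′ k′≡k+1) (countB-prefix-inCyc v k k′))
    }

  Dominated⇒≲ : ∀ {u v} → Dominated (u ⟨$⟩ʳ_) (v ⟨$⟩ʳ_) → u ≲[ a ] v
  Dominated⇒≲ {u} {v} u⊴v =
    (λ k → from (≤ₛ⇔prefixCount-below-≥ u v (suc (toℕ k)) (a k)) (lowCount-≥ k)) ,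
    (λ k k′ k′≡k+1 → trans (countB-prefix-inCyc u k k′) (trans (cyclicCount-≡ k k′ k′≡k+1) (sym (countB-prefix-inCyc v k k′))))
    where open Dominated u⊴v

  laterBelow : (Fin n → Fin n) → Fin n → ℕ → ℕ
  laterBelow w p C = countWhere (λ q → toℕ p <ᵇ toℕ q) w (below (a p) C)

  inversions : (Fin n → Fin n) → ℕ
  inversions w = ∑[ p < n ] laterBelow w p (rk (a p) (w p))

  inversions-cong : ∀ {w w′} → (∀ p → w p ≡ w′ p) → inversions w ≡ inversions w′
  inversions-cong w≗w′ = sum-cong-≗ (λ p → sum-cong-≗ (λ q →
    cong₂ (λ c d → 𝟙 ((toℕ p <ᵇ toℕ q) ∧ below (a p) (rk (a p) c) d)) (w≗w′ p) (w≗w′ q)))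

  tiltedLength≡inversions : ∀ w → tiltedLength a w ≡ inversions (w ⟨$⟩ʳ_)
  tiltedLength≡inversions w = trans
    (countB-concatMap-tabulate P (λ p → List.map (p ,_) (List.allFin n)) (λ p → p))
    (sum-cong-≗ (λ p → trans (countB-map P (p ,_) (List.allFin n)) (countB-tabulate (λ q → P (p , q)) (λ q → q))))
    where
    P : Fin n × Fin n → Bool
    P pq = let p = proj₁ pq ; q = proj₂ pq in
      (toℕ p <ᵇ toℕ q) ∧ below (a p) (rk (a p) (w ⟨$⟩ʳ p)) (w ⟨$⟩ʳ q)

module _ {n : ℕ} (a : Vector (Fin n) n) {u v : Fin n → Fin n} (u⊴v : Dominated a u v) where

  open Dominated u⊴v

  window-count-≥ : ∀ k k′ → toℕ k′ ≡ suc (toℕ k) → ∀ {Y} → rk (a k) (a k′) ≤ Y →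
    prefixCount v (suc (toℕ k)) (window (a k) (rk (a k) (a k′)) Y) ≤ prefixCount u (suc (toℕ k)) (window (a k) (rk (a k) (a k′)) Y)
  window-count-≥ k k′ k′≡k+1 {Y} s≤Y = +-cancelˡ-≤ (cyclicCount a u k k′) _ _ (begin
    cyclicCount a u k k′ + W v   ≡⟨ cong (_+ W v) (cyclicCount-≡ k k′ k′≡k+1) ⟩
    cyclicCount a v k k′ + W v   ≡⟨ lowCount≡ v ⟨
    lowCount a v k (suc Y)       ≤⟨ lowCount-≥ k (suc Y) ⟩
    lowCount a u k (suc Y)       ≡⟨ lowCount≡ u ⟩
    cyclicCount a u k k′ + W u   ∎)
    where
    open ≤-Reasoning
    W : (Fin n → Fin n) → ℕ
    W w = prefixCount w (suc (toℕ k)) (window (a k) (rk (a k) (a k′)) Y)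
    lowCount≡ : ∀ w → lowCount a w k (suc Y) ≡ cyclicCount a w k k′ + W w
    lowCount≡ w = countWhere-split _ w {below (a k) (suc Y)} {inCyc (a k) (a k′)} {window (a k) (rk (a k) (a k′)) Y}
                    (below-split-window (a k) (a k′) s≤Y)

-- Exchanging the first difference

-- A position q with a_q ∈ (x, y] is called a cut.
record ExchangePosition {n} (a : Vector (Fin n) n) (u : Fin n → Fin n) (i x y : Fin n) : Set where
  field
    j         : Fin n
    i<j       : toℕ i < toℕ j
    u[j]∈     : u j ∈⟨ x , y ]
    u-outside : ∀ p → toℕ i < toℕ p → toℕ p < toℕ j → ¬ u p ∈⟨ x , y ]
    no-cut    : ∀ q → toℕ i ≤ toℕ q → toℕ q ≤ toℕ j → ¬ a q ∈⟨ x , y ]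

module AtFirstDifference {n : ℕ} (a : Vector (Fin n) n) (u v : Permutation′ n)
  (u⊴v : Dominated a (u ⟨$⟩ʳ_) (v ⟨$⟩ʳ_)) (i : Fin n)
  (agree : ∀ p → toℕ p < toℕ i → u ⟨$⟩ʳ p ≡ v ⟨$⟩ʳ p) (x≢y : u ⟨$⟩ʳ i ≢ v ⟨$⟩ʳ i) where

  open Dominated u⊴v

  U V : Fin n → Fin n
  U = u ⟨$⟩ʳ_
  V = v ⟨$⟩ʳ_

  x y : Fin n
  x = U i
  y = V i

  prefix-agree : ∀ (P : Fin n → Bool) p → p ≢ i →
    𝟙 ((toℕ p <ᵇ suc (toℕ i)) ∧ P (V p)) ≡ 𝟙 ((toℕ p <ᵇ suc (toℕ i)) ∧ P (U p))
  prefix-agree P p p≢i with toℕ p <? toℕ i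
  ... | yes p<i rewrite agree p p<i = refl
  ... | no p≮i  = cong 𝟙 (trans (<ᵇ∧-false _ p≮i+1) (sym (<ᵇ∧-false _ p≮i+1)))
    where
    p≮i+1 : toℕ p ≮ suc (toℕ i)
    p≮i+1 p<i+1 = p≮i (≤∧≢⇒< (s≤s⁻¹ p<i+1) (p≢i ∘ toℕ-injective))

  x<y : x <[ a i ] y
  x<y = ≤∧≢⇒< (s≤s⁻¹ x<y+1) (x≢y ∘ rk-injective (a i))
    where
    Y : ℕ
    Y = rk (a i) y
    i<i+1 : toℕ i < suc (toℕ i)
    i<i+1 = n<1+n (toℕ i)
    at-i : 𝟙 (below (a i) (suc Y) y) ≤ 𝟙 (below (a i) (suc Y) x)
    at-i = subst₂ (λ b c → 𝟙 b ≤ 𝟙 c) (<ᵇ∧-true (below (a i) (suc Y) y) i<i+1) (<ᵇ∧-true (below (a i) (suc Y) x) i<i+1)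
             (sum-≤⇒≤-at i (prefix-agree (below (a i) (suc Y))) (lowCount-≥ i (suc Y)))
    x<y+1 : rk (a i) x < suc Y
    x<y+1 with rk (a i) x <? suc Y
    ... | yes x<y+1 = x<y+1
    ... | no x≮y+1  = ⊥-elim (1+n≰n (subst₂ (λ b c → 𝟙 b ≤ 𝟙 c) (<⇒<ᵇ≡true (n<1+n Y)) (≮⇒<ᵇ≡false x≮y+1) at-i))

  compensating-position : ∀ (P : Fin n → Bool) k → toℕ i < k → P y ≡ true → P x ≡ false →
    prefixCount V k P ≤ prefixCount U k P → Σ[ p ∈ Fin n ] (toℕ i < toℕ p × toℕ p < k × P (U p) ≡ true)
  compensating-position P k i<k Py Px V≤U with any? (λ p → (toℕ i <? toℕ p) ×-dec ((toℕ p <? k) ×-dec (P (U p) ≟ᵇ true)))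
  ... | yes found = found
  ... | no none   = ⊥-elim (m+1+n≰m (prefixCount U k P) (≤-trans (sum-≤-except i later at-i) V≤U))
    where
    later : ∀ p → p ≢ i → 𝟙 ((toℕ p <ᵇ k) ∧ P (U p)) ≤ 𝟙 ((toℕ p <ᵇ k) ∧ P (V p))
    later p p≢i with toℕ p <? toℕ i
    ... | yes p<i rewrite agree p p<i = ≤-refl
    ... | no p≮i with (toℕ p <ᵇ k) ∧ P (U p) in counted
    ...   | false = z≤n
    ...   | true  = ⊥-elim (none (p , ≤∧≢⇒< (≮⇒≥ p≮i) (p≢i ∘ sym ∘ toℕ-injective) ,
                                   <ᵇ≡true⇒< (proj₁ (∧≡true⇒ counted)) , proj₂ (∧≡true⇒ counted)))
    at-i : 𝟙 ((toℕ i <ᵇ k) ∧ P x) + 1 ≤ 𝟙 ((toℕ i <ᵇ k) ∧ P y)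
    at-i rewrite <ᵇ∧-true (P x) i<k | <ᵇ∧-true (P y) i<k | Px | Py = ≤-refl

  exchange-from-witness : ∀ p → toℕ i < toℕ p → U p ∈⟨ x , y ] →
    (∀ q → toℕ i ≤ toℕ q → toℕ q ≤ toℕ p → ¬ a q ∈⟨ x , y ]) → ExchangePosition a U i x y
  exchange-from-witness p i<p Up∈ p-no-cut
    with least-witness (λ q → (toℕ i <? toℕ q) ×-dec (U q ∈⟨ x , y ]?)) (i<p , Up∈)
  ... | j , (i<j , Uj∈) , j-least = record
    { j = j ; i<j = i<j ; u[j]∈ = Uj∈
    ; u-outside = λ q i<q q<j Uq∈ → j-least q q<j (i<q , Uq∈)
    ; no-cut    = λ q i≤q q≤j → p-no-cut q i≤q (≤-trans q≤j j≤p)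
    }
    where
    j≤p : toℕ j ≤ toℕ p
    j≤p = ≮⇒≥ (λ p<j → j-least p p<j (i<p , Up∈))

  exchange-without-cut : (∀ q → toℕ i ≤ toℕ q → ¬ a q ∈⟨ x , y ]) → ExchangePosition a U i x y
  exchange-without-cut none = exchange-from-witness m i<m Um∈ (λ q i≤q _ → none q i≤q)
    where
    m : Fin n
    m = u ⟨$⟩ˡ y
    Um≡y : U m ≡ y
    Um≡y = inverseʳ u
    m≢i : m ≢ i
    m≢i m≡i = x≢y (trans (cong U (sym m≡i)) Um≡y)
    i<m : toℕ i < toℕ m
    i<m with toℕ m <? toℕ i
    ... | yes m<i = ⊥-elim (m≢i (⟨$⟩ʳ-injective v (trans (sym (agree m m<i)) Um≡y)))
    ... | no m≮i  = ≤∧≢⇒< (≮⇒≥ m≮i) (m≢i ∘ sym ∘ toℕ-injective)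
    Um∈ : U m ∈⟨ x , y ]
    Um∈ rewrite Um≡y = ≤∧≢⇒< z≤n (x≢y ∘ rk≡0⇒≡ ∘ sym) , ≤-refl

  -- In the order of a_k, the prefixes of length K = k + 1 of u and v have equally many values
  -- below a_K and v's has at most as many up to y, so at most as many in [a_K, y].  Since
  -- v_i = y lies in that window and u_i = x does not, some later u_p must.
  value-before-cut : ∀ k K → toℕ K ≡ suc (toℕ k) → toℕ i ≤ toℕ k → ¬ a k ∈⟨ x , y ] → a K ∈⟨ x , y ] →
    Σ[ p ∈ Fin n ] (toℕ i < toℕ p × toℕ p ≤ toℕ k × U p ∈⟨ x , y ])
  value-before-cut k K K≡k+1 i≤k ak∉ aK∈ =
    let p , i<p , p<k+1 , Up-in = compensating-position in-window (suc (toℕ k)) (s≤s i≤k) y-in x-out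
                                    (window-count-≥ a u⊴v k K K≡k+1 s≤y)
        s≤Up , Up≤y = ∧≡true⇒ Up-in
    in p , i<p , s≤s⁻¹ p<k+1 , between⇒∈⟨] r (<-≤-trans x<s (≤ᵇ≡true⇒≤ s≤Up)) (≤ᵇ≡true⇒≤ Up≤y)
    where
    r : Fin n
    r = a k
    x<s : x <[ r ] a K
    x<s = proj₁ (∈⟨]⇒between r (base∉⟨]⇒< r x≢y ak∉) aK∈)
    s≤y : a K ≤[ r ] y
    s≤y = proj₂ (∈⟨]⇒between r (base∉⟨]⇒< r x≢y ak∉) aK∈)
    in-window : Fin n → Bool
    in-window = window r (rk r (a K)) (rk r y)
    y-in : in-window y ≡ true
    y-in = trans (cong (_∧ (rk r y ≤ᵇ rk r y)) (≤⇒≤ᵇ≡true s≤y)) (≤⇒≤ᵇ≡true (≤-refl {rk r y}))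
    x-out : in-window x ≡ false
    x-out = cong (_∧ (rk r x ≤ᵇ rk r y)) (≰⇒≤ᵇ≡false (<⇒≱ x<s))

  exchange-before-cut : ∀ K → toℕ i ≤ toℕ K → a K ∈⟨ x , y ] →
    (∀ q → toℕ q < toℕ K → ¬ (toℕ i ≤ toℕ q × a q ∈⟨ x , y ])) → ExchangePosition a U i x y
  exchange-before-cut K i≤K aK∈ K-least =
    let p , i<p , p≤k , Up∈ = value-before-cut k K K≡k+1 i≤k (λ ak∈ → K-least k k<K (i≤k , ak∈)) aK∈
    in exchange-from-witness p i<p Up∈ (λ q i≤q q≤p aq∈ → K-least q (≤-<-trans q≤p (≤-<-trans p≤k k<K)) (i≤q , aq∈))
    where
    i<K : toℕ i < toℕ K
    i<K = ≤∧≢⇒< i≤K (λ i≡K → <⇒base∉⟨] (a i) x<y (subst (λ q → a q ∈⟨ x , y ]) (sym (toℕ-injective i≡K)) aK∈))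
    k : Fin n
    k = proj₁ (predecessor K (≤-<-trans z≤n i<K))
    K≡k+1 : toℕ K ≡ suc (toℕ k)
    K≡k+1 = proj₂ (predecessor K (≤-<-trans z≤n i<K))
    k<K : toℕ k < toℕ K
    k<K = subst (toℕ k <_) (sym K≡k+1) (n<1+n (toℕ k))
    i≤k : toℕ i ≤ toℕ k
    i≤k = s≤s⁻¹ (subst (toℕ i <_) K≡k+1 i<K)

  exchangePosition : ExchangePosition a U i x y
  exchangePosition with any? (λ q → (toℕ i ≤? toℕ q) ×-dec (a q ∈⟨ x , y ]?))
  ... | yes (q , cut) = let K , (i≤K , aK∈) , K-least = least-witness (λ q → (toℕ i ≤? toℕ q) ×-dec (a q ∈⟨ x , y ]?)) cut
                        in exchange-before-cut K i≤K aK∈ K-least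
  ... | no none       = exchange-without-cut (λ q i≤q aq∈ → none (q , i≤q , aq∈))

  open ExchangePosition exchangePosition

  z : Permutation′ n
  z = transpose i j ∘ₚ u

  Z : Fin n → Fin n
  Z = z ⟨$⟩ʳ_

  y′ : Fin n
  y′ = U j

  i≢j : i ≢ j
  i≢j i≡j = <-irrefl (cong toℕ i≡j) i<j

  Z-i : Z i ≡ y′
  Z-i = cong U (transpose-at-i i j)

  Z-j : Z j ≡ x
  Z-j = cong U (transpose-at-j i j)

  Z-elsewhere : ∀ {p} → p ≢ i → p ≢ j → Z p ≡ U p
  Z-elsewhere p≢i p≢j = cong U (transpose-elsewhere p≢i p≢j)

  x<y′ : ∀ {r} → ¬ r ∈⟨ x , y ] → x <[ r ] y′
  x<y′ {r} r∉ = proj₁ (∈⟨]⇒between r (base∉⟨]⇒< r x≢y r∉) u[j]∈)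

  y′≤y : ∀ {r} → ¬ r ∈⟨ x , y ] → y′ ≤[ r ] y
  y′≤y {r} r∉ = proj₂ (∈⟨]⇒between r (base∉⟨]⇒< r x≢y r∉) u[j]∈)

  same-side : ∀ {r w} → ¬ r ∈⟨ x , y ] → ¬ w ∈⟨ x , y ] → (x <[ r ] w ⇔ y′ <[ r ] w)
  same-side {r} {w} r∉ w∉ = mk⇔ x<w⇒y′<w (<-trans (x<y′ r∉))
    where
    x<w⇒y′<w : x <[ r ] w → y′ <[ r ] w
    x<w⇒y′<w x<w with rk r w ≤? rk r y
    ... | yes w≤y = ⊥-elim (w∉ (between⇒∈⟨] r x<w w≤y))
    ... | no w≰y  = ≤-<-trans (y′≤y r∉) (≰⇒> w≰y)

  inCyc-x-y′≡false : ∀ {w} → w ≢ x → ¬ w ∈⟨ x , y ] → inCyc x y′ w ≡ false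
  inCyc-x-y′≡false {w} w≢x w∉ = trans (inCyc≡<[] x y′ w) (≮⇒<ᵇ≡false (λ w<y′ →
    w∉ (≤∧≢⇒< z≤n (w≢x ∘ sym ∘ rk≡0⇒≡ ∘ sym) , ≤-trans (<⇒≤ w<y′) (proj₂ u[j]∈))))

  data Region (k : Fin n) : Set where
    before  : toℕ k < toℕ i → Region k
    between : toℕ i ≤ toℕ k → toℕ k < toℕ j → Region k
    after   : toℕ j ≤ toℕ k → Region k

  region : ∀ k → Region k
  region k with toℕ k <? toℕ i | toℕ k <? toℕ j
  ... | yes k<i | _       = before k<i
  ... | no k≮i  | yes k<j = between (≮⇒≥ k≮i) k<j
  ... | no _    | no k≮j  = after (≮⇒≥ k≮j)

  no-cut-between : ∀ {k : Fin n} → toℕ i ≤ toℕ k → toℕ k < toℕ j → ¬ a k ∈⟨ x , y ]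
  no-cut-between i≤k k<j = no-cut _ i≤k (<⇒≤ k<j)

  no-cut-next : ∀ {k : Fin n} k′ → toℕ k′ ≡ suc (toℕ k) → toℕ i ≤ toℕ k → toℕ k < toℕ j → ¬ a k′ ∈⟨ x , y ]
  no-cut-next k′ k′≡k+1 i≤k k<j =
    no-cut k′ (≤-trans i≤k (≤-trans (n≤1+n _) (≤-reflexive (sym k′≡k+1)))) (subst (_≤ _) (sym k′≡k+1) k<j)

  prefixCount-outside : ∀ {k : Fin n} (P : Fin n → Bool) → toℕ k < toℕ i ⊎ toℕ j ≤ toℕ k →
    prefixCount Z (suc (toℕ k)) P ≡ prefixCount U (suc (toℕ k)) P
  prefixCount-outside {k} P outside = countWhere-transpose-≡ _ U P i≢j (same outside)
    where
    same : toℕ k < toℕ i ⊎ toℕ j ≤ toℕ k → (toℕ i <ᵇ suc (toℕ k)) ≡ (toℕ j <ᵇ suc (toℕ k))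
    same (inj₁ k<i) = trans (≮⇒<ᵇ≡false (<⇒≱ k<i ∘ s≤s⁻¹)) (sym (≮⇒<ᵇ≡false (<⇒≱ (<-trans k<i i<j) ∘ s≤s⁻¹)))
    same (inj₂ j≤k) = trans (<⇒<ᵇ≡true (s≤s (≤-trans (<⇒≤ i<j) j≤k))) (sym (<⇒<ᵇ≡true (s≤s j≤k)))

  prefixCount-between : ∀ {k : Fin n} (P : Fin n → Bool) → toℕ i ≤ toℕ k → toℕ k < toℕ j →
    prefixCount Z (suc (toℕ k)) P + 𝟙 (P x) ≡ prefixCount U (suc (toℕ k)) P + 𝟙 (P y′)
  prefixCount-between {k} P i≤k k<j =
    countWhere-transpose-inˡ _ U P (<⇒<ᵇ≡true (s≤s i≤k)) (≮⇒<ᵇ≡false (<⇒≱ k<j ∘ s≤s⁻¹))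

  u⊴z : Dominated a U Z
  u⊴z = record { lowCount-≥ = lowCount-≥-uz ; cyclicCount-≡ = cyclicCount-≡-uz }
    where
    lowCount-≥-uz : ∀ k t → lowCount a Z k t ≤ lowCount a U k t
    lowCount-≥-uz k t with region k
    ... | before k<i      = ≤-reflexive (prefixCount-outside (below (a k) t) (inj₁ k<i))
    ... | after j≤k       = ≤-reflexive (prefixCount-outside (below (a k) t) (inj₂ j≤k))
    ... | between i≤k k<j = +-cancelʳ-≤ (𝟙 (below (a k) t x)) _ _ (begin
      lowCount a Z k t + 𝟙 (below (a k) t x)   ≡⟨ prefixCount-between (below (a k) t) i≤k k<j ⟩
      lowCount a U k t + 𝟙 (below (a k) t y′)  ≤⟨ +-monoʳ-≤ _ (𝟙-<ᵇ-antitoneˡ t (<⇒≤ (x<y′ (no-cut-between i≤k k<j)))) ⟩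
      lowCount a U k t + 𝟙 (below (a k) t x)   ∎)
      where open ≤-Reasoning
    cyclicCount-≡-uz : ∀ k k′ → toℕ k′ ≡ suc (toℕ k) → cyclicCount a U k k′ ≡ cyclicCount a Z k k′
    cyclicCount-≡-uz k k′ k′≡k+1 with region k
    ... | before k<i      = sym (prefixCount-outside (inCyc (a k) (a k′)) (inj₁ k<i))
    ... | after j≤k       = sym (prefixCount-outside (inCyc (a k) (a k′)) (inj₂ j≤k))
    ... | between i≤k k<j = sym (+-cancelʳ-≡ _ _ _ (trans (prefixCount-between (inCyc (a k) (a k′)) i≤k k<j)
          (cong (λ b → cyclicCount a U k k′ + 𝟙 b) (sym x∼y′))))
      where
      x∼y′ : inCyc (a k) (a k′) x ≡ inCyc (a k) (a k′) y′
      x∼y′ = trans (inCyc≡<[] (a k) (a k′) x) (trans (<ᵇ-cong (same-side (no-cut-between i≤k k<j) (no-cut-next k′ k′≡k+1 i≤k k<j)))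
               (sym (inCyc≡<[] (a k) (a k′) y′)))

  -- For i < p ≤ k the value u_p lies outside (x, y], so for it having rank below t and rank
  -- at most y are the same; hence the bound for v at threshold rk y + 1 transfers to t.
  lowCount-crossing : ∀ {k t} → toℕ i ≤ toℕ k → toℕ k < toℕ j → rk (a k) x < t → t ≤ rk (a k) y′ →
    lowCount a V k t ≤ lowCount a Z k t
  lowCount-crossing {k} {t} i≤k k<j x<t t≤y′ = +-cancelʳ-≤ (lowCount a U k (suc Y)) _ _ (begin
    lowCount a V k t + lowCount a U k (suc Y)  ≤⟨ countWhere-+-≤ _ {below r t} {below r (suc Y)} {V} {U} {Z} {V} pointwise ⟩
    lowCount a Z k t + lowCount a V k (suc Y)  ≤⟨ +-monoʳ-≤ _ (lowCount-≥ k (suc Y)) ⟩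
    lowCount a Z k t + lowCount a U k (suc Y)  ∎)
    where
    open ≤-Reasoning
    r : Fin n
    r = a k
    Y : ℕ
    Y = rk r y
    t≤y : t ≤ Y
    t≤y = ≤-trans t≤y′ (y′≤y (no-cut-between i≤k k<j))
    t≤y+1 : t ≤ suc Y
    t≤y+1 = ≤-trans t≤y (n≤1+n Y)
    Bound : Fin n → Set
    Bound p = 𝟙 (below r t (V p)) + 𝟙 (below r (suc Y) (U p)) ≤ 𝟙 (below r t (Z p)) + 𝟙 (below r (suc Y) (V p))
    pointwise : ∀ p → (toℕ p <ᵇ suc (toℕ k)) ≡ true → Bound p
    pointwise p p≤k with toℕ p <? toℕ i
    ... | yes p<i = ≤-reflexive (cong₂ (λ w w′ → 𝟙 (below r t w) + 𝟙 (below r (suc Y) w′))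
                                        (trans (sym (agree p p<i)) (sym Zp≡Up)) (agree p p<i))
      where
      Zp≡Up : Z p ≡ U p
      Zp≡Up = Z-elsewhere (λ p≡i → <-irrefl (cong toℕ p≡i) p<i) (λ p≡j → <-irrefl (cong toℕ p≡j) (<-trans p<i i<j))
    ... | no p≮i = at-or-after (p ≟ i)
      where
      at-or-after : Dec (p ≡ i) → Bound p
      at-or-after (yes refl) = begin
        𝟙 (below r t y) + 𝟙 (below r (suc Y) x)
          ≡⟨ cong₂ (λ b c → 𝟙 b + 𝟙 c) (≮⇒<ᵇ≡false (≤⇒≯ t≤y)) (<⇒<ᵇ≡true (s≤s (<⇒≤ x<ᵣy))) ⟩
        1
          ≡⟨ cong₂ (λ b c → 𝟙 b + 𝟙 c) (trans (cong (below r t) Z-i) (≮⇒<ᵇ≡false (≤⇒≯ t≤y′))) (<⇒<ᵇ≡true (n<1+n Y)) ⟨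
        𝟙 (below r t (Z i)) + 𝟙 (below r (suc Y) y) ∎
        where
        x<ᵣy : x <[ r ] y
        x<ᵣy = base∉⟨]⇒< r x≢y (no-cut-between i≤k k<j)
      at-or-after (no p≢i) = begin
        𝟙 (below r t (V p)) + 𝟙 (below r (suc Y) (U p))  ≡⟨ cong (λ b → 𝟙 (below r t (V p)) + 𝟙 b) (below-outside r Up∉ x<t t≤y+1) ⟩
        𝟙 (below r t (V p)) + 𝟙 (below r t (U p))        ≤⟨ +-monoˡ-≤ (𝟙 (below r t (U p))) (𝟙-<ᵇ-monotoneʳ (rk r (V p)) t≤y+1) ⟩
        𝟙 (below r (suc Y) (V p)) + 𝟙 (below r t (U p))  ≡⟨ +-comm (𝟙 (below r (suc Y) (V p))) _ ⟩
        𝟙 (below r t (U p)) + 𝟙 (below r (suc Y) (V p))  ≡⟨ cong (λ w → 𝟙 (below r t w) + _) (Z-elsewhere p≢i p≢j) ⟨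
        𝟙 (below r t (Z p)) + 𝟙 (below r (suc Y) (V p))  ∎
        where
        i<p : toℕ i < toℕ p
        i<p = ≤∧≢⇒< (≮⇒≥ p≮i) (p≢i ∘ sym ∘ toℕ-injective)
        p<j : toℕ p < toℕ j
        p<j = ≤-<-trans (s≤s⁻¹ (<ᵇ≡true⇒< p≤k)) k<j
        p≢j : p ≢ j
        p≢j p≡j = <-irrefl (cong toℕ p≡j) p<j
        Up∉ : ¬ U p ∈⟨ x , y ]
        Up∉ = u-outside p i<p p<j

  z⊴v : Dominated a Z V
  z⊴v = record { lowCount-≥ = lowCount-≥-zv ; cyclicCount-≡ = cyclicCount-≡-zv }
    where
    open Dominated u⊴z renaming (lowCount-≥ to lowCount-≥-uz; cyclicCount-≡ to cyclicCount-≡-uz)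
    lowCount-≥-zv : ∀ k t → lowCount a V k t ≤ lowCount a Z k t
    lowCount-≥-zv k t with region k
    ... | before k<i      = ≤-trans (lowCount-≥ k t) (≤-reflexive (sym (prefixCount-outside (below (a k) t) (inj₁ k<i))))
    ... | after j≤k       = ≤-trans (lowCount-≥ k t) (≤-reflexive (sym (prefixCount-outside (below (a k) t) (inj₂ j≤k))))
    ... | between i≤k k<j with rk (a k) x <? t | rk (a k) y′ <? t
    ...   | no x≮t  | _       = ≤-trans (lowCount-≥ k t) (+-≡-≤⇒≤ (sym (prefixCount-between (below (a k) t) i≤k k<j))
                                  (≤-trans (≤-reflexive (cong 𝟙 (≮⇒<ᵇ≡false x≮t))) z≤n))
    ...   | yes _   | yes y′<t = ≤-trans (lowCount-≥ k t) (+-≡-≤⇒≤ (sym (prefixCount-between (below (a k) t) i≤k k<j))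
                                  (≤-trans (𝟙≤1 _) (≤-reflexive (cong 𝟙 (sym (<⇒<ᵇ≡true y′<t))))))
    ...   | yes x<t | no y′≮t = lowCount-crossing i≤k k<j x<t (≮⇒≥ y′≮t)
    cyclicCount-≡-zv : ∀ k k′ → toℕ k′ ≡ suc (toℕ k) → cyclicCount a Z k k′ ≡ cyclicCount a V k k′
    cyclicCount-≡-zv k k′ k′≡k+1 = trans (sym (cyclicCount-≡-uz k k′ k′≡k+1)) (cyclicCount-≡ k k′ k′≡k+1)

  laterBelow-elsewhere : ∀ {p} → p ≢ i → p ≢ j → laterBelow a Z p (rk (a p) (Z p)) ≡ laterBelow a U p (rk (a p) (U p))
  laterBelow-elsewhere {p} p≢i p≢j =
    trans (cong (laterBelow a Z p ∘ rk (a p)) (Z-elsewhere p≢i p≢j)) (by-position (toℕ p <? toℕ i) (toℕ j <? toℕ p))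
    where
    S : Fin n → Bool
    S q = toℕ p <ᵇ toℕ q
    P : Fin n → Bool
    P = below (a p) (rk (a p) (U p))
    by-position : Dec (toℕ p < toℕ i) → Dec (toℕ j < toℕ p) → countWhere S Z P ≡ countWhere S U P
    by-position (yes p<i) _ =
      countWhere-transpose-≡ S U P i≢j (trans (<⇒<ᵇ≡true p<i) (sym (<⇒<ᵇ≡true (<-trans p<i i<j))))
    by-position (no _) (yes j<p) =
      countWhere-transpose-≡ S U P i≢j (trans (≮⇒<ᵇ≡false (<⇒≯ (<-trans i<j j<p))) (sym (≮⇒<ᵇ≡false (<⇒≯ j<p))))
    by-position (no p≮i) (no j≮p) = +-cancelʳ-≡ _ _ _ (begin
      countWhere S Z P + 𝟙 (P y′)  ≡⟨ countWhere-transpose-inʳ S U P (≮⇒<ᵇ≡false (<⇒≯ i<p)) (<⇒<ᵇ≡true p<j) ⟩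
      countWhere S U P + 𝟙 (P x)   ≡⟨ cong (λ b → countWhere S U P + 𝟙 b) y′∼x ⟨
      countWhere S U P + 𝟙 (P y′)  ∎)
      where
      open ≡-Reasoning
      i<p : toℕ i < toℕ p
      i<p = ≤∧≢⇒< (≮⇒≥ p≮i) (p≢i ∘ sym ∘ toℕ-injective)
      p<j : toℕ p < toℕ j
      p<j = ≤∧≢⇒< (≮⇒≥ j≮p) (p≢j ∘ toℕ-injective)
      y′∼x : P y′ ≡ P x
      y′∼x = sym (<ᵇ-cong (same-side (no-cut p (<⇒≤ i<p) (<⇒≤ p<j)) (u-outside p i<p p<j)))

  -- For q > j, u_q lies below y′ exactly when it lies below x or in [x, y′), in the order of
  -- a_i as well as of a_j, so rows i and j only exchange that term; q = j gives the new inversion.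
  laterBelow-at-i-j : laterBelow a Z i (rk (a i) y′) + laterBelow a Z j (rk (a j) x)
                        ≡ laterBelow a U i (rk (a i) x) + laterBelow a U j (rk (a j) y′) + 1
  laterBelow-at-i-j = begin
    laterBelow a Z i (rk (a i) y′) + laterBelow a Z j (rk (a j) x)     ≡⟨ ∑-distrib-+ zi zj ⟨
    ∑[ q < n ] (zi q + zj q)                                          ≡⟨ +-identityʳ _ ⟨
    ∑[ q < n ] (zi q + zj q) + 0                                      ≡⟨ sum-≡-except j elsewhere at-j ⟩
    ∑[ q < n ] (ui q + uj q) + 1                                      ≡⟨ cong (_+ 1) (∑-distrib-+ ui uj) ⟩
    laterBelow a U i (rk (a i) x) + laterBelow a U j (rk (a j) y′) + 1 ∎
    where
    open ≡-Reasoning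
    zi zj ui uj : Fin n → ℕ
    zi q = 𝟙 ((toℕ i <ᵇ toℕ q) ∧ below (a i) (rk (a i) y′) (Z q))
    zj q = 𝟙 ((toℕ j <ᵇ toℕ q) ∧ below (a j) (rk (a j) x) (Z q))
    ui q = 𝟙 ((toℕ i <ᵇ toℕ q) ∧ below (a i) (rk (a i) x) (U q))
    uj q = 𝟙 ((toℕ j <ᵇ toℕ q) ∧ below (a j) (rk (a j) y′) (U q))
    x<y′-at-i : x <[ a i ] y′
    x<y′-at-i = x<y′ (no-cut i ≤-refl (<⇒≤ i<j))
    x<y′-at-j : x <[ a j ] y′
    x<y′-at-j = x<y′ (no-cut j (<⇒≤ i<j) ≤-refl)
    at-j : zi j + zj j + 0 ≡ ui j + uj j + 1
    at-j rewrite Z-j | <⇒<ᵇ≡true i<j | ≮⇒<ᵇ≡false (n≮n (toℕ j)) | <⇒<ᵇ≡true x<y′-at-i | ≮⇒<ᵇ≡false (<⇒≯ x<y′-at-i) = refl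
    elsewhere : ∀ q → q ≢ j → zi q + zj q ≡ ui q + uj q
    elsewhere q q≢j with toℕ i <? toℕ q
    ... | no i≮q rewrite ≮⇒<ᵇ≡false i≮q | ≮⇒<ᵇ≡false (i≮q ∘ <-trans i<j) = refl
    ... | yes i<q rewrite <⇒<ᵇ≡true i<q | Z-elsewhere (λ q≡i → <-irrefl (cong toℕ (sym q≡i)) i<q) q≢j with toℕ j <? toℕ q
    ...   | no j≮q rewrite ≮⇒<ᵇ≡false j≮q =
      cong (_+ 0) (trans (below-split-inCyc (a i) x<y′-at-i (U q))
        (trans (cong (λ b → 𝟙 (below (a i) (rk (a i) x) (U q)) + 𝟙 b) (inCyc-x-y′≡false Uq≢x Uq∉)) (+-identityʳ _)))
      where
      Uq≢x : U q ≢ x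
      Uq≢x Uq≡x = <-irrefl (cong toℕ (sym (⟨$⟩ʳ-injective u Uq≡x))) i<q
      Uq∉ : ¬ U q ∈⟨ x , y ]
      Uq∉ = u-outside q i<q (≤∧≢⇒< (≮⇒≥ j≮q) (q≢j ∘ toℕ-injective))
    ...   | yes j<q rewrite <⇒<ᵇ≡true j<q | below-split-inCyc (a i) x<y′-at-i (U q) | below-split-inCyc (a j) x<y′-at-j (U q) =
      xy∙z≈x∙zy (𝟙 (below (a i) (rk (a i) x) (U q))) (𝟙 (inCyc x y′ (U q))) (𝟙 (below (a j) (rk (a j) x) (U q)))

  inversions-transposition : inversions a Z ≡ suc (inversions a U)
  inversions-transposition = begin
    inversions a Z      ≡⟨ +-identityʳ _ ⟨
    inversions a Z + 0  ≡⟨ sum-≡-except₂ i≢j (λ _ → laterBelow-elsewhere) at-i-j ⟩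
    inversions a U + 1  ≡⟨ +-comm _ 1 ⟩
    suc (inversions a U) ∎
    where
    open ≡-Reasoning
    at-i-j : laterBelow a Z i (rk (a i) (Z i)) + laterBelow a Z j (rk (a j) (Z j)) + 0
               ≡ laterBelow a U i (rk (a i) x) + laterBelow a U j (rk (a j) y′) + 1
    at-i-j rewrite Z-i | Z-j = trans (+-identityʳ _) laterBelow-at-i-j

  tiltedLength-cover : (∀ w → u ≲[ a ] w → w ≲[ a ] v → w ≐ u ⊎ w ≐ v) → tiltedLength a v ≡ suc (tiltedLength a u)
  tiltedLength-cover covers with covers z (Dominated⇒≲ a {u} {z} u⊴z) (Dominated⇒≲ a {z} {v} z⊴v)
  ... | inj₁ z≐u = ⊥-elim (i≢j (⟨$⟩ʳ-injective u (trans (sym (z≐u i)) Z-i)))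
  ... | inj₂ z≐v = begin
    tiltedLength a v        ≡⟨ tiltedLength≡inversions a v ⟩
    inversions a V          ≡⟨ inversions-cong a z≐v ⟨
    inversions a Z          ≡⟨ inversions-transposition ⟩
    suc (inversions a U)    ≡⟨ cong suc (tiltedLength≡inversions a u) ⟨
    suc (tiltedLength a u)  ∎
    where open ≡-Reasoning

firstDifference : ∀ {n} (u v : Permutation′ n) → ¬ u ≐ v →
  Σ[ i ∈ Fin n ] ((∀ p → toℕ p < toℕ i → u ⟨$⟩ʳ p ≡ v ⟨$⟩ʳ p) × u ⟨$⟩ʳ i ≢ v ⟨$⟩ʳ i)
firstDifference {n} u v u≢v =
  let p , up≢vp = ¬∀⟶∃¬ n _ (λ p → u ⟨$⟩ʳ p ≟ v ⟨$⟩ʳ p) u≢v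
      i , ui≢vi , i-least = least-witness (λ p → ¬? (u ⟨$⟩ʳ p ≟ v ⟨$⟩ʳ p)) up≢vp
  in i , (λ p p<i → decidable-stable (u ⟨$⟩ʳ p ≟ v ⟨$⟩ʳ p) (i-least p p<i)) , ui≢vi

theorem3p18 : (n : ℕ) (a : Vector (Fin n) n) (w w' : Permutation′ n) →
    Covers a w w' → tiltedLength a w' ≡ suc (tiltedLength a w)
theorem3p18 n a u v (u≲v , u≢v , covers) =
  let i , agree , x≢y = firstDifference u v u≢v
  in AtFirstDifference.tiltedLength-cover a u v (≲⇒Dominated a {u} {v} u≲v) i agree x≢y covers
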